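{- Let $\mathbf v=\mathbf v_{a_rb_r}\cdots\mathbf v_{a_1b_1}$ be a composition of operators with $\mathbf v\not\equiv\mathbf 0$. Suppose that $a_{r+1},b_{r+1}$ are positive integers with $a_{r+1}\neq b_{r+1}$ and $a_{r+1},b_{r+1}\notin\{a_1,b_1,\dots,a_r,b_r\}$. Then $\mathbf v_{a_{r+1}b_{r+1}}\mathbf v\equiv\mathbf 0$ if and only if $\mathbf v_{a_{r+1}b_{r+1}}\mathbf v_{a_ib_i}\equiv\mathbf 0$ for some $1\le i\le r$.
   Context: For a positive integer $N$, $[N]=\{1,\dots,N\}$, $S_N$ is the symmetric group on $[N]$, $s_{ab}$ the transposition exchanging $a,b$, $\ell$ the number of inversions. With commuting indeterminates $q_1,\dots,q_{N-1}$, $\mathbf q^\alpha=\prod q_i^{\alpha_i}$, $\mathbf q_{ij}=q_i\cdots q_{j-1}$ ($i<j$), $S_N[\mathbf q]=\{\mathbf q^\alpha w\}$, $\ell(\mathbf q^\alpha w)=\ell(w)+2\deg\mathbf q^\alpha$. For $k\in[N-1]$ the quantum $k$-Bruhat order has covers, for $w\in S_N$ and $i\le k<j$: $w\lessdot_k ws_{ij}$ if $\ell(ws_{ij})=\ell(w)+1$, $w\lessdot_k\mathbf q_{ij}ws_{ij}$ if $\ell(\mathbf q_{ij}ws_{ij})=\ell(w)+1$; extended $\mathbf q$-multiplicatively. Operators $\mathbf v_{ab}$ ($a\neq b$ positive integers) generate a free monoid, with zero element $\mathbf 0$; a composition $\mathbf v_{a_rb_r}\cdots\mathbf v_{a_1b_1}$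 has support $\{a_1,b_1,\dots,a_r,b_r\}$. For support in $[N]$, $k\in[N-1]$, $u\in S_N$: $\mathbf v_{ab}\bullet_ku=s_{ab}u$ if $a<b$ and $u\lessdot_ks_{ab}u$; $=\mathbf q_{ij}s_{ab}u$ if $a>b$, $i=u^{ -1}(a)$, $j=u^{ -1}(b)$ and $u\lessdot_k\mathbf q_{ij}s_{ab}u$; $=0$ otherwise; extended by $\mathbf v\bullet_k(\mathbf q^\alpha u)=\mathbf q^\alpha(\mathbf v\bullet_ku)$, $\bullet_k0=0$, compositions acting rightmost operator first. $\mathbf v\equiv\mathbf 0$ means $\mathbf v\bullet_kx=0$ for all $N$ with support in $[N]$, all $x\in S_N[\mathbf q]$, $k\in[N-1]$. -}

module Defs where

open import Data.Nat using (ℕ; zero; suc; _+_; _*_; _∸_; _≤_; _<_; _≤ᵇ_; _<ᵇ_)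
open import Data.Bool using (Bool; true; false; if_then_else_; _∧_)
open import Data.Fin using (Fin; toℕ)
open import Data.Fin.Properties using () renaming (_≟_ to _≟F_)
open import Data.Fin.Permutation using (Permutation′; _⟨$⟩ʳ_)
open import Data.List using (List; []; _∷_; map; allFin; concatMap)
open import Data.Nat.ListAction using (sum)
open import Data.List.Relation.Unary.All using (All)
open import Data.Product using (Σ; _×_; _,_)
open import Data.Sum using (_⊎_)
open import Relation.Nullary using (¬_; does)
open import Relation.Binary.PropositionalEquality using (_≡_; _≢_)

-- An element w of S_N is used through its underlying function
-- Fin N → Fin N; the value/position a ∈ [N] corresponds to the Fin element
-- a' with suc (toℕ a') ≡ a (i.e. 0-based internally).
Fun : ℕ → Set
Fun N = Fin N → Fin N

-- exponent vectors α for q^α = q_1^{α_1} ⋯ q_{N-1}^{α_{N-1}};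
-- the component m : Fin (N ∸ 1) is the exponent of q_{toℕ m + 1}.
Exps : ℕ → Set
Exps N = Fin (N ∸ 1) → ℕ

swapF : ∀ {N} → Fin N → Fin N → Fin N → Fin N
swapF i j x = if does (x ≟F i) then j else (if does (x ≟F j) then i else x)

len : ∀ {N} → Fun N → ℕ
len {N} w = sum (map (λ p → sum (map (λ q →
  if (toℕ p <ᵇ toℕ q) ∧ (toℕ (w q) <ᵇ toℕ (w p)) then 1 else 0) (allFin N))) (allFin N))

deg : ∀ {N} → Exps N → ℕ
deg {N} α = sum (map α (allFin (N ∸ 1)))

lenq : ∀ {N} → Exps N → Fun N → ℕ
lenq {N} α w = len w + 2 * deg {N} α

-- exponent vector of q_{ij} = q_i ⋯ q_{j-1}  (positions i, j given 0-based,
-- i.e. 1-based positions toℕ i + 1 < toℕ j + 1)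
qvec : ∀ {N} → Fin N → Fin N → Exps N
qvec i j m = if (toℕ i ≤ᵇ toℕ m) ∧ (toℕ m <ᵇ toℕ j) then 1 else 0

-- Cover k w β y :  w ⋖_k q^β y  in the quantum k-Bruhat order (w ∈ S_N plain).
Cover : ∀ {N} → ℕ → Fun N → Exps N → Fun N → Set
Cover {N} k w β y =
  Σ (Fin N) λ i → Σ (Fin N) λ j →
    (toℕ i < toℕ j) × (suc (toℕ i) ≤ k) × (k < suc (toℕ j)) ×
    (∀ x → y x ≡ w (swapF i j x)) ×
    ( ((∀ m → β m ≡ 0) × (len y ≡ len w + 1))
    ⊎ ((∀ m → β m ≡ qvec i j m) × (lenq {N} β y ≡ len w + 1)) )

-- Step k a b u β u' :  v_ab •_k u = q^β u'  (nonzero).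
Step : ∀ {N} → ℕ → ℕ → ℕ → Fun N → Exps N → Fun N → Set
Step {N} k a b u β u' =
  Σ (Fin N) λ a' → Σ (Fin N) λ b' →
    (suc (toℕ a') ≡ a) × (suc (toℕ b') ≡ b) ×
    (∀ x → u' x ≡ swapF a' b' (u x)) ×
    ( ((a < b) × (∀ m → β m ≡ 0) × Cover k u β u')
    ⊎ ((b < a) × Σ (Fin N) λ i → Σ (Fin N) λ j →
         -- i = u⁻¹(a), j = u⁻¹(b); q_ij requires i < j
         (u i ≡ a') × (u j ≡ b') × (toℕ i < toℕ j) ×
         (∀ m → β m ≡ qvec i j m) × Cover k u β u') )

-- A composition v_{a_r b_r} ⋯ v_{a_1 b_1} is the list
-- (a_r , b_r) ∷ ⋯ ∷ (a_1 , b_1) ∷ []  (written order; rightmost acts first).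
Word : Set
Word = List (ℕ × ℕ)

-- Run k v α u γ y :  v •_k (q^α u) = q^γ y  (nonzero)
Run : ∀ {N} → ℕ → Word → Exps N → Fun N → Exps N → Fun N → Set
Run k [] α u γ y = (∀ m → γ m ≡ α m) × (∀ x → y x ≡ u x)
Run {N} k ((a , b) ∷ v) α u γ y =
  Σ (Exps N) λ α' → Σ (Fun N) λ u' → Run k v α u α' u' ×
  Σ (Exps N) λ β → Step k a b u' β y × (∀ m → γ m ≡ α' m + β m)

support : Word → List ℕ
support = concatMap (λ { (a , b) → a ∷ b ∷ [] })

ValidOp : ℕ × ℕ → Set
ValidOp (a , b) = (1 ≤ a) × (1 ≤ b) × (a ≢ b)

InRange : ℕ → ℕ → Set
InRange N a = (1 ≤ a) × (a ≤ N)

IsZero : Word → Set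
IsZero v = ∀ (N : ℕ) → All (InRange N) (support v) →
  ∀ (α : Exps N) (u : Permutation′ N) (k : ℕ) → 1 ≤ k → k ≤ N ∸ 1 →
  ¬ (Σ (Exps N) λ γ → Σ (Fun N) λ y → Run k v α (u ⟨$⟩ʳ_) γ y)

-- A nonzero v_cd •_k w exchanges the value c, at a position i < k, with the value d, at a position
-- j ≥ k; by the length formula for w s_ij the condition is that every value at a position strictly
-- between i and j is passable for v_cd. As a and b do not occur in v, their positions stay fixed
-- along v. If some letter v_cd of v is incompatible with v_ab, then right after it some value between
-- a and b is impassable for v_ab, and from then on one always is, so v_ab v ≡ 0. If every letter is
-- compatible, a nonzero run of v can be relaid: delete a and b and reinsert them on either side of the
-- wall with exactly the values passable for v_ab between them; every letter still acts, and then so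
-- does v_ab. Compatibility is decidable and, by the case v = v_cd, characterises v_ab v_cd ≢ 0.

module Submission where

open import Defs
open import Data.Bool using (Bool; true; false; not; _∧_; if_then_else_; T)
open import Data.Bool.Properties using (∧-comm; ∧-inverseʳ; ∧-zeroʳ)
open import Data.Empty using (⊥-elim)
open import Data.Fin using (Fin; zero; suc; toℕ; fromℕ<)
open import Data.Fin.Permutation using (Permutation′; _⟨$⟩ʳ_; _⟨$⟩ˡ_; permutation)
import Data.Fin.Permutation as Perm
import Data.Fin.Permutation.Components as PC
open import Data.Fin.Properties using (toℕ-injective; toℕ<n; toℕ≤pred[n]; toℕ-fromℕ<; fromℕ<-toℕ; _≟_)
open import Data.List using (List; []; _∷_; _++_; length; map; allFin; tabulate; filter)
open import Data.List.Membership.Propositional using (_∈_; find; lose)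
open import Data.List.Membership.Propositional.Properties using (∈-∃++; ∈-++⁺ˡ; ∈-++⁺ʳ; ∈-++⁻; ∈-filter⁺; ∈-filter⁻)
open import Data.List.Properties
  using (map-tabulate; ++-assoc; ++-identityʳ; length-++; length-++-≤ˡ; filter-++; filter-accept; filter-reject)
open import Data.List.Relation.Binary.Permutation.Propositional
  using (_↭_; ↭-refl; ↭-sym; ↭-trans; prep; swap; ↭⇒↭ₛ; module PermutationReasoning)
open import Data.List.Relation.Binary.Permutation.Propositional.Properties
  using (All-resp-↭; ∈-resp-↭; shift; ++⁺ˡ; ++-comm) renaming (++⁺ to ++⁺-↭)
open import Data.List.Relation.Unary.All as All using (All; []; _∷_; all?)
open import Data.List.Relation.Unary.All.Properties using (++⁺; ++⁻ˡ; ++⁻ʳ; filter⁺; all-filter; ¬All⇒Any¬)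
open import Data.List.Relation.Unary.AllPairs using ([]; _∷_)
open import Data.List.Relation.Unary.Any using (Any; here; there)
open import Data.List.Relation.Unary.Unique.Propositional using (Unique)
import Data.List.Relation.Unary.Unique.Propositional.Properties as Unique
open import Data.Nat using (ℕ; zero; suc; _+_; _*_; _∸_; _⊔_; _<_; _≤_; _<ᵇ_; _≤ᵇ_; s≤s; z≤n; s<s; s<s⁻¹; s≤s⁻¹; z<s)
open import Data.Nat.ListAction using (sum)
open import Data.Nat.Properties hiding (_≟_)
open import Data.Nat.Properties using () renaming (_≟_ to _≟ℕ_)
open import Algebra.Properties.Semiring.Sum +-*-semiring
  using (sum-syntax; sum-cong-≗; ∑-distrib-+; ∑-comm; ∑-permute; *-distribˡ-sum)
open import Data.Nat.Tactic.RingSolver using (solve-∀)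
open import Data.Product using (Σ; _×_; _,_; proj₁; proj₂)
open import Data.Sum using (_⊎_; inj₁; inj₂)
open import Data.Unit using (tt)
open import Function using (_∘_; id)
open import Function.Bundles using (_⇔_; mk⇔; Equivalence)
open import Function.Definitions using (Injective)
open import Relation.Binary.Definitions using (Tri; tri<; tri≈; tri>)
open import Relation.Binary.PropositionalEquality
open import Data.List.Relation.Binary.Permutation.Setoid.Properties (setoid ℕ) using (Unique-resp-↭)
open import Relation.Nullary using (¬_; Dec; yes; no; does; ¬?; _×-dec_; _⊎-dec_; _→-dec_)
open import Relation.Nullary.Decidable using (dec-true; dec-false)
open import Relation.Unary using (Decidable)
open import Relation.Unary.Properties using (∁?)

sum-allFin : ∀ n (f : Fin n → ℕ) → sum (map f (allFin n)) ≡ ∑[ x < n ] f x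
sum-allFin zero    f = refl
sum-allFin (suc n) f = cong (f zero +_) (begin
  sum (map f (tabulate suc))        ≡⟨ cong sum (trans (map-tabulate suc f) (sym (map-tabulate id (f ∘ suc)))) ⟩
  sum (map (f ∘ suc) (allFin n))    ≡⟨ sum-allFin n (f ∘ suc) ⟩
  ∑[ x < n ] f (suc x)              ∎)
  where open ≡-Reasoning

∑-zero : ∀ {n} (f : Fin n → ℕ) → (∀ x → f x ≡ 0) → ∑[ x < n ] f x ≡ 0
∑-zero {zero}  f f≡0 = refl
∑-zero {suc n} f f≡0 = cong₂ _+_ (f≡0 zero) (∑-zero (f ∘ suc) (f≡0 ∘ suc))

∑-mono-≤ : ∀ {n} (f g : Fin n → ℕ) → (∀ x → f x ≤ g x) → ∑[ x < n ] f x ≤ ∑[ x < n ] g x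
∑-mono-≤ {zero}  f g f≤g = z≤n
∑-mono-≤ {suc n} f g f≤g = +-mono-≤ (f≤g zero) (∑-mono-≤ (f ∘ suc) (g ∘ suc) (f≤g ∘ suc))

≤∧∑≡⇒≗ : ∀ {n} (f g : Fin n → ℕ) → (∀ x → f x ≤ g x) → ∑[ x < n ] f x ≡ ∑[ x < n ] g x → ∀ x → f x ≡ g x
≤∧∑≡⇒≗ f g f≤g ∑f≡∑g zero = ≤-antisym (f≤g zero) (+-cancelʳ-≤ _ _ _ (begin
  g zero + ∑[ x < _ ] f (suc x)  ≤⟨ +-monoʳ-≤ (g zero) (∑-mono-≤ (f ∘ suc) (g ∘ suc) (f≤g ∘ suc)) ⟩
  g zero + ∑[ x < _ ] g (suc x)  ≡⟨ ∑f≡∑g ⟨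
  f zero + ∑[ x < _ ] f (suc x)  ∎))
  where open ≤-Reasoning
≤∧∑≡⇒≗ f g f≤g ∑f≡∑g (suc x) = ≤∧∑≡⇒≗ (f ∘ suc) (g ∘ suc) (f≤g ∘ suc)
  (+-cancelˡ-≡ (f zero) _ _ (trans ∑f≡∑g (cong (_+ _) (sym (≤∧∑≡⇒≗ f g f≤g ∑f≡∑g zero))))) x

∑∑-+ : ∀ {N} (f g : Fin N → Fin N → ℕ) →
  ∑[ p < N ] ∑[ q < N ] (f p q + g p q) ≡ ∑[ p < N ] ∑[ q < N ] f p q + ∑[ p < N ] ∑[ q < N ] g p q
∑∑-+ {N} f g = trans (sum-cong-≗ {N} (λ p → ∑-distrib-+ {N} (f p) (g p))) (∑-distrib-+ {N} _ _)

𝟙 : Bool → ℕ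
𝟙 b = if b then 1 else 0

δ : ∀ {n} → Fin n → Fin n → ℕ
δ x y = 𝟙 (does (x ≟ y))

δ-refl : ∀ {n} (x : Fin n) → δ x x ≡ 1
δ-refl x = cong 𝟙 (dec-true (x ≟ x) refl)

δ-≢ : ∀ {n} {x y : Fin n} → x ≢ y → δ x y ≡ 0
δ-≢ {x = x} {y} x≢y = cong 𝟙 (dec-false (x ≟ y) x≢y)

∑-δ : ∀ {n} (y : Fin n) (f : Fin n → ℕ) → ∑[ x < n ] (δ x y * f x) ≡ f y
∑-δ zero    f = trans (cong₂ _+_ (+-identityʳ (f zero)) (∑-zero (λ x → δ (suc x) zero * f (suc x)) (λ _ → refl))) (+-identityʳ (f zero))
∑-δ (suc y) f = ∑-δ y (f ∘ suc)

<ᵇ-suc : ∀ l m → (l <ᵇ suc m) ≡ (l ≤ᵇ m)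
<ᵇ-suc zero    m = refl
<ᵇ-suc (suc l) m = refl

∑-interval : ∀ n lo hi → hi ≤ n → ∑[ m < n ] 𝟙 ((lo ≤ᵇ toℕ m) ∧ (toℕ m <ᵇ hi)) ≡ hi ∸ lo
∑-interval zero    lo       zero     _         = sym (0∸n≡0 lo)
∑-interval (suc n) lo       zero     _         = trans (∑-zero {suc n} (λ m → 𝟙 ((lo ≤ᵇ toℕ m) ∧ false)) (λ m → cong 𝟙 (∧-zeroʳ (lo ≤ᵇ toℕ m)))) (sym (0∸n≡0 lo))
∑-interval (suc n) zero     (suc hi) (s≤s h≤n) = cong suc (∑-interval n zero hi h≤n)
∑-interval (suc n) (suc lo) (suc hi) (s≤s h≤n) =
  trans (sum-cong-≗ {n} (λ m → cong (λ b → 𝟙 (b ∧ (toℕ m <ᵇ hi))) (<ᵇ-suc lo (toℕ m)))) (∑-interval n lo hi h≤n)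

-- Transpositions of positions

swapF-left : ∀ {n} (i j : Fin n) → swapF i j i ≡ j
swapF-left i j rewrite dec-true (i ≟ i) refl = refl

swapF-right : ∀ {n} (i j : Fin n) → swapF i j j ≡ i
swapF-right i j with j ≟ i
... | yes j≡i = j≡i
... | no _ rewrite dec-true (j ≟ j) refl = refl

swapF-other : ∀ {n} {i j x : Fin n} → x ≢ i → x ≢ j → swapF i j x ≡ x
swapF-other {i = i} {j} {x} x≢i x≢j rewrite dec-false (x ≟ i) x≢i | dec-false (x ≟ j) x≢j = refl

data Location {n} (i j x : Fin n) : Set where
  at-left  : x ≡ i → Location i j x
  at-right : x ≡ j → Location i j x
  off      : x ≢ i → x ≢ j → Location i j x

locate : ∀ {n} (i j x : Fin n) → Location i j x
locate i j x with x ≟ i | x ≟ j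
... | yes x≡i | _       = at-left x≡i
... | no _    | yes x≡j = at-right x≡j
... | no x≢i  | no x≢j  = off x≢i x≢j

swapF-involutive : ∀ {n} (i j x : Fin n) → swapF i j (swapF i j x) ≡ x
swapF-involutive i j x with locate i j x
... | at-left refl  = trans (cong (swapF x j) (swapF-left x j)) (swapF-right x j)
... | at-right refl = trans (cong (swapF i x) (swapF-right i x)) (swapF-left i x)
... | off x≢i x≢j   = trans (cong (swapF i j) (swapF-other x≢i x≢j)) (swapF-other x≢i x≢j)

swapF-injective : ∀ {n} (i j : Fin n) → Injective _≡_ _≡_ (swapF i j)
swapF-injective i j {x} {y} e = trans (sym (swapF-involutive i j x)) (trans (cong (swapF i j) e) (swapF-involutive i j y))

swapF≗transpose : ∀ {n} (i j x : Fin n) → swapF i j x ≡ PC.transpose i j x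
swapF≗transpose i j x with x ≟ i
... | yes _ = refl
... | no _ with x ≟ j
... | yes _ = refl
... | no _  = refl

∑-swapF : ∀ {n} (i j : Fin n) (f : Fin n → ℕ) → ∑[ x < n ] f (swapF i j x) ≡ ∑[ x < n ] f x
∑-swapF {n} i j f = sym (trans (∑-permute f (Perm.transpose i j)) (sum-cong-≗ {n} (λ x → cong f (sym (swapF≗transpose i j x)))))

-- Inversions and the length change under a transposition

_≺_ : ∀ {n} → Fin n → Fin n → Bool
p ≺ q = does (toℕ p <? toℕ q)

≺-true : ∀ {n} {p q : Fin n} → toℕ p < toℕ q → (p ≺ q) ≡ true
≺-true {p = p} {q} = dec-true (toℕ p <? toℕ q)

≺-false : ∀ {n} {p q : Fin n} → ¬ toℕ p < toℕ q → (p ≺ q) ≡ false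
≺-false {p = p} {q} = dec-false (toℕ p <? toℕ q)

≺-sound : ∀ {n} {p q : Fin n} → (p ≺ q) ≡ true → toℕ p < toℕ q
≺-sound {p = p} {q} e = <ᵇ⇒< (toℕ p) (toℕ q) (subst T (sym e) tt)

≺-irrefl : ∀ {n} (p : Fin n) → (p ≺ p) ≡ false
≺-irrefl p = ≺-false {p = p} {p} (<-irrefl refl)

not-≺ : ∀ {n} {p q : Fin n} → p ≢ q → not (p ≺ q) ≡ (q ≺ p)
not-≺ {p = p} {q} p≢q with <-cmp (toℕ p) (toℕ q)
... | tri< p<q _ q≮p rewrite ≺-true p<q | ≺-false q≮p = refl
... | tri≈ _ p≡q _   = ⊥-elim (p≢q (toℕ-injective p≡q))
... | tri> p≮q _ q<p rewrite ≺-false p≮q | ≺-true q<p = refl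

len-∑ : ∀ {N} (w : Fun N) → len w ≡ ∑[ p < N ] ∑[ q < N ] 𝟙 (p ≺ q ∧ w q ≺ w p)
len-∑ {N} w = trans (sum-allFin N (λ p → sum (map (λ q → 𝟙 (p ≺ q ∧ w q ≺ w p)) (allFin N))))
  (sum-cong-≗ {N} (λ p → sum-allFin N (λ q → 𝟙 (p ≺ q ∧ w q ≺ w p))))

len-cong : ∀ {N} {w w′ : Fun N} → (∀ x → w x ≡ w′ x) → len w ≡ len w′
len-cong {N} {w} {w′} w≗w′ = begin
  len w                                            ≡⟨ len-∑ w ⟩
  ∑[ p < N ] ∑[ q < N ] 𝟙 (p ≺ q ∧ w q ≺ w p)      ≡⟨ sum-cong-≗ {N} (λ p → sum-cong-≗ {N} (λ q →
                                                        cong₂ (λ x y → 𝟙 (p ≺ q ∧ x ≺ y)) (w≗w′ q) (w≗w′ p))) ⟩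
  ∑[ p < N ] ∑[ q < N ] 𝟙 (p ≺ q ∧ w′ q ≺ w′ p)    ≡⟨ len-∑ w′ ⟨
  len w′                                           ∎
  where open ≡-Reasoning

inside : ∀ {N} → Fin N → Fin N → Fin N → Bool
inside i j m = i ≺ m ∧ m ≺ j

flipped : ∀ {N} → Fin N → Fin N → Fin N → Fin N → Bool
flipped i j p q = p ≺ q ∧ not (swapF i j p ≺ swapF i j q)

module _ {N : ℕ} {i j : Fin N} (i<j : toℕ i < toℕ j) where

  private
    i≢j : i ≢ j
    i≢j i≡j = <-irrefl (cong toℕ i≡j) i<j

    after-j : ∀ q → (j ≺ q ∧ not (i ≺ q)) ≡ false
    after-j q with toℕ j <? toℕ q
    ... | yes j<q rewrite ≺-true j<q | ≺-true (<-trans i<j j<q) = refl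
    ... | no j≮q  rewrite ≺-false j≮q = refl

    before-i : ∀ p → (p ≺ i ∧ not (p ≺ j)) ≡ false
    before-i p with toℕ p <? toℕ i
    ... | yes p<i rewrite ≺-true p<i | ≺-true (<-trans p<i i<j) = refl
    ... | no p≮i  rewrite ≺-false p≮i = refl

  -- The flipped pairs are (i, q) with i < q ≤ j and (p, j) with i < p < j.
  flipped-split : ∀ (E : Fin N → Fin N → Bool) p q →
    𝟙 (flipped i j p q ∧ E p q) ≡ δ p i * 𝟙 ((i ≺ q ∧ not (j ≺ q)) ∧ E i q) + δ q j * 𝟙 (inside i j p ∧ E p j)
  flipped-split E p q with locate i j p | locate i j q
  ... | at-left refl | at-left refl
    rewrite swapF-left i j | ≺-irrefl i | δ-refl i | δ-≢ i≢j = refl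
  ... | at-left refl | at-right refl
    rewrite swapF-left i j | swapF-right i j | ≺-true i<j | ≺-false (<-asym i<j) | ≺-irrefl i | ≺-irrefl j | δ-refl i | δ-refl j
    = sym (trans (+-identityʳ _) (+-identityʳ _))
  ... | at-left refl | off q≢i q≢j
    rewrite swapF-left i j | swapF-other q≢i q≢j | δ-refl i | δ-≢ q≢j = sym (trans (+-identityʳ _) (+-identityʳ _))
  ... | at-right refl | at-left refl
    rewrite swapF-left i j | swapF-right i j | ≺-false (<-asym i<j) | δ-≢ i≢j | δ-≢ (i≢j ∘ sym) = refl
  ... | at-right refl | at-right refl
    rewrite swapF-right i j | ≺-irrefl j | ∧-zeroʳ (i ≺ j) | δ-≢ (i≢j ∘ sym) | δ-refl j = refl
  ... | at-right refl | off q≢i q≢j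
    rewrite swapF-right i j | swapF-other q≢i q≢j | δ-≢ (i≢j ∘ sym) | δ-≢ q≢j | after-j q = refl
  ... | off p≢i p≢j | at-left refl
    rewrite swapF-left i j | swapF-other p≢i p≢j | δ-≢ p≢i | δ-≢ i≢j | before-i p = refl
  ... | off p≢i p≢j | at-right refl
    rewrite swapF-right i j | swapF-other p≢i p≢j | δ-≢ p≢i | δ-refl j | not-≺ p≢i
    = trans (cong (λ b → 𝟙 (b ∧ E p j)) (∧-comm (p ≺ j) (i ≺ p))) (sym (+-identityʳ _))
  ... | off p≢i p≢j | off q≢i q≢j
    rewrite swapF-other p≢i p≢j | swapF-other q≢i q≢j | δ-≢ p≢i | δ-≢ q≢j | ∧-inverseʳ (p ≺ q) = refl

  ∑-up-to-j : ∀ (F : Fin N → Bool) →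
    ∑[ q < N ] 𝟙 ((i ≺ q ∧ not (j ≺ q)) ∧ F q) ≡ 𝟙 (F j) + ∑[ q < N ] 𝟙 (inside i j q ∧ F q)
  ∑-up-to-j F = trans (sum-cong-≗ {N} split) (trans (∑-distrib-+ {N} _ _) (cong (_+ ∑[ q < N ] 𝟙 (inside i j q ∧ F q)) (∑-δ j (λ _ → 𝟙 (F j)))))
    where
    split : ∀ q → 𝟙 ((i ≺ q ∧ not (j ≺ q)) ∧ F q) ≡ δ q j * 𝟙 (F j) + 𝟙 (inside i j q ∧ F q)
    split q with q ≟ j
    ... | yes refl rewrite ≺-true i<j | ≺-irrefl q = sym (trans (+-identityʳ _) (+-identityʳ _))
    ... | no q≢j   rewrite not-≺ (q≢j ∘ sym) = refl

  flipped-sum : ∀ (E : Fin N → Fin N → Bool) →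
    ∑[ p < N ] ∑[ q < N ] 𝟙 (flipped i j p q ∧ E p q)
      ≡ 𝟙 (E i j) + (∑[ m < N ] 𝟙 (inside i j m ∧ E i m) + ∑[ m < N ] 𝟙 (inside i j m ∧ E m j))
  flipped-sum E = begin
    ∑[ p < N ] ∑[ q < N ] 𝟙 (flipped i j p q ∧ E p q)
      ≡⟨ sum-cong-≗ {N} (λ p → trans (sum-cong-≗ {N} (flipped-split E p)) (∑-distrib-+ {N} _ _)) ⟩
    ∑[ p < N ] (∑[ q < N ] (δ p i * X q) + ∑[ q < N ] (δ q j * Y p))
      ≡⟨ ∑-distrib-+ {N} _ _ ⟩
    ∑[ p < N ] ∑[ q < N ] (δ p i * X q) + ∑[ p < N ] ∑[ q < N ] (δ q j * Y p)
      ≡⟨ cong₂ _+_ (trans (sum-cong-≗ {N} (λ p → sym (*-distribˡ-sum (δ p i) X))) (∑-δ i (λ _ → ∑[ q < N ] X q)))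
                   (sum-cong-≗ {N} (λ p → ∑-δ j (λ _ → Y p))) ⟩
    ∑[ q < N ] X q + ∑[ p < N ] Y p
      ≡⟨ cong (_+ ∑[ p < N ] Y p) (∑-up-to-j (E i)) ⟩
    𝟙 (E i j) + ∑[ m < N ] 𝟙 (inside i j m ∧ E i m) + ∑[ p < N ] Y p
      ≡⟨ +-assoc (𝟙 (E i j)) _ _ ⟩
    𝟙 (E i j) + (∑[ m < N ] 𝟙 (inside i j m ∧ E i m) + ∑[ m < N ] 𝟙 (inside i j m ∧ E m j)) ∎
    where
    open ≡-Reasoning
    X Y : Fin N → ℕ
    X q = 𝟙 ((i ≺ q ∧ not (j ≺ q)) ∧ E i q)
    Y p = 𝟙 (inside i j p ∧ E p j)

flipped-reversed : ∀ {N} (i j p q : Fin N) → (swapF i j p ≺ swapF i j q ∧ not (p ≺ q)) ≡ flipped i j q p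
flipped-reversed i j p q with p ≟ q
... | yes refl rewrite ≺-irrefl (swapF i j p) | ≺-irrefl p = refl
... | no p≢q   rewrite not-≺ p≢q | sym (not-≺ (p≢q ∘ swapF-injective i j ∘ sym)) = ∧-comm _ (q ≺ p)

𝟙-exchange : ∀ X Y E → 𝟙 (X ∧ E) + 𝟙 ((Y ∧ not X) ∧ E) ≡ 𝟙 (Y ∧ E) + 𝟙 ((X ∧ not Y) ∧ E)
𝟙-exchange false false E = refl
𝟙-exchange false true  E = +-comm 0 (𝟙 E)
𝟙-exchange true  false E = +-comm (𝟙 E) 0
𝟙-exchange true  true  E = refl

-- Compare the inversions of w s_ij and of w pair by pair: only the flipped pairs change status.
len-balance : ∀ {N} (w : Fun N) (i j : Fin N) →
  len (w ∘ swapF i j) + ∑[ p < N ] ∑[ q < N ] 𝟙 (flipped i j p q ∧ w q ≺ w p)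
    ≡ len w + ∑[ p < N ] ∑[ q < N ] 𝟙 (flipped i j p q ∧ w p ≺ w q)
len-balance {N} w i j = begin
  len (w ∘ s) + ∑[ p < N ] ∑[ q < N ] 𝟙 ((p ≺ q ∧ not (s p ≺ s q)) ∧ w q ≺ w p)
    ≡⟨ cong (_+ ∑[ p < N ] ∑[ q < N ] 𝟙 ((p ≺ q ∧ not (s p ≺ s q)) ∧ w q ≺ w p)) len-reindexed ⟩
  ∑[ p < N ] ∑[ q < N ] 𝟙 (s p ≺ s q ∧ w q ≺ w p) + ∑[ p < N ] ∑[ q < N ] 𝟙 ((p ≺ q ∧ not (s p ≺ s q)) ∧ w q ≺ w p)
    ≡⟨ ∑∑-+ (λ p q → 𝟙 (s p ≺ s q ∧ w q ≺ w p)) (λ p q → 𝟙 ((p ≺ q ∧ not (s p ≺ s q)) ∧ w q ≺ w p)) ⟨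
  ∑[ p < N ] ∑[ q < N ] (𝟙 (s p ≺ s q ∧ w q ≺ w p) + 𝟙 ((p ≺ q ∧ not (s p ≺ s q)) ∧ w q ≺ w p))
    ≡⟨ sum-cong-≗ {N} (λ p → sum-cong-≗ {N} (λ q → 𝟙-exchange (s p ≺ s q) (p ≺ q) (w q ≺ w p))) ⟩
  ∑[ p < N ] ∑[ q < N ] (𝟙 (p ≺ q ∧ w q ≺ w p) + 𝟙 ((s p ≺ s q ∧ not (p ≺ q)) ∧ w q ≺ w p))
    ≡⟨ ∑∑-+ (λ p q → 𝟙 (p ≺ q ∧ w q ≺ w p)) (λ p q → 𝟙 ((s p ≺ s q ∧ not (p ≺ q)) ∧ w q ≺ w p)) ⟩
  ∑[ p < N ] ∑[ q < N ] 𝟙 (p ≺ q ∧ w q ≺ w p) + ∑[ p < N ] ∑[ q < N ] 𝟙 ((s p ≺ s q ∧ not (p ≺ q)) ∧ w q ≺ w p)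
    ≡⟨ cong₂ _+_ (sym (len-∑ w)) (sum-cong-≗ {N} (λ p → sum-cong-≗ {N} (λ q →
         cong (λ b → 𝟙 (b ∧ w q ≺ w p)) (flipped-reversed i j p q)))) ⟩
  len w + ∑[ p < N ] ∑[ q < N ] 𝟙 (flipped i j q p ∧ w q ≺ w p)
    ≡⟨ cong (len w +_) (∑-comm (λ p q → 𝟙 (flipped i j q p ∧ w q ≺ w p))) ⟩
  len w + ∑[ p < N ] ∑[ q < N ] 𝟙 (flipped i j p q ∧ w p ≺ w q) ∎
  where
  open ≡-Reasoning
  s = swapF i j
  len-reindexed : len (w ∘ s) ≡ ∑[ p < N ] ∑[ q < N ] 𝟙 (s p ≺ s q ∧ w q ≺ w p)
  len-reindexed = begin
    len (w ∘ s)                                             ≡⟨ len-∑ (w ∘ s) ⟩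
    ∑[ p < N ] ∑[ q < N ] 𝟙 (p ≺ q ∧ w (s q) ≺ w (s p))      ≡⟨ ∑-swapF i j _ ⟨
    ∑[ p < N ] ∑[ q < N ] 𝟙 (s p ≺ q ∧ w (s q) ≺ w (s (s p)))
      ≡⟨ sum-cong-≗ {N} (λ p → sym (∑-swapF i j (λ q → 𝟙 (s p ≺ q ∧ w (s q) ≺ w (s (s p)))))) ⟩
    ∑[ p < N ] ∑[ q < N ] 𝟙 (s p ≺ s q ∧ w (s (s q)) ≺ w (s (s p)))
      ≡⟨ sum-cong-≗ {N} (λ p → sum-cong-≗ {N} (λ q → cong₂ (λ x y → 𝟙 (s p ≺ s q ∧ w x ≺ w y))
           (swapF-involutive i j q) (swapF-involutive i j p))) ⟩
    ∑[ p < N ] ∑[ q < N ] 𝟙 (s p ≺ s q ∧ w q ≺ w p)           ∎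

Between : ∀ {N} → Fin N → Fin N → Fin N → Set
Between i j m = toℕ i < toℕ m × toℕ m < toℕ j

inside-true : ∀ {N} {i j m : Fin N} → Between i j m → inside i j m ≡ true
inside-true (i<m , m<j) rewrite ≺-true i<m | ≺-true m<j = refl

inside-sound : ∀ {N} {i j m : Fin N} → inside i j m ≡ true → Between i j m
inside-sound {i = i} {j} {m} e with i ≺ m in i≺m | m ≺ j in m≺j
... | true | true = ≺-sound i≺m , ≺-sound m≺j

𝟙-false : ∀ {b} → 𝟙 b ≡ 0 → b ≡ false
𝟙-false {false} _ = refl

𝟙-true : ∀ {b} → 𝟙 b ≡ 1 → b ≡ true
𝟙-true {true} _ = refl

𝟙-∧-≤ : ∀ b c → 𝟙 (b ∧ c) ≤ 𝟙 b
𝟙-∧-≤ false c = z≤n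
𝟙-∧-≤ true  c = 𝟙≤1 c
  where
  𝟙≤1 : ∀ c → 𝟙 c ≤ 1
  𝟙≤1 false = z≤n
  𝟙≤1 true  = ≤-refl

count : ∀ {N} → Fin N → Fin N → (Fin N → Bool) → ℕ
count {N} i j P = ∑[ m < N ] 𝟙 (inside i j m ∧ P m)

module _ {N : ℕ} (i j : Fin N) (P : Fin N → Bool) where

  count-all : ∑[ m < N ] 𝟙 (inside i j m) ≡ toℕ j ∸ suc (toℕ i)
  count-all = ∑-interval N (suc (toℕ i)) (toℕ j) (<⇒≤ (toℕ<n j))

  count-zero : count i j P ≡ 0 → ∀ m → Between i j m → P m ≡ false
  count-zero count≡0 m b = 𝟙-false (begin
    𝟙 (P m)                   ≡⟨ cong (λ x → 𝟙 (x ∧ P m)) (inside-true b) ⟨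
    𝟙 (inside i j m ∧ P m)    ≡⟨ ≤∧∑≡⇒≗ (λ _ → 0) (λ m → 𝟙 (inside i j m ∧ P m)) (λ _ → z≤n)
                                   (trans (∑-zero {N} (λ _ → 0) (λ _ → refl)) (sym count≡0)) m ⟨
    0                         ∎)
    where open ≡-Reasoning

  zero-count : (∀ m → Between i j m → P m ≡ false) → count i j P ≡ 0
  zero-count none = ∑-zero (λ m → 𝟙 (inside i j m ∧ P m)) term
    where
    term : ∀ m → 𝟙 (inside i j m ∧ P m) ≡ 0
    term m with inside i j m in e
    ... | false = refl
    ... | true  = cong 𝟙 (none m (inside-sound e))

  count-full : count i j P ≡ toℕ j ∸ suc (toℕ i) → ∀ m → Between i j m → P m ≡ true
  count-full full m b = 𝟙-true (begin
    𝟙 (P m)                   ≡⟨ cong (λ x → 𝟙 (x ∧ P m)) (inside-true b) ⟨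
    𝟙 (inside i j m ∧ P m)    ≡⟨ ≤∧∑≡⇒≗ (λ m → 𝟙 (inside i j m ∧ P m)) (λ m → 𝟙 (inside i j m))
                                   (λ m → 𝟙-∧-≤ (inside i j m) (P m)) (trans full (sym count-all)) m ⟩
    𝟙 (inside i j m)          ≡⟨ cong 𝟙 (inside-true b) ⟩
    1                         ∎)
    where open ≡-Reasoning

  full-count : (∀ m → Between i j m → P m ≡ true) → count i j P ≡ toℕ j ∸ suc (toℕ i)
  full-count all = trans (sum-cong-≗ {N} term) count-all
    where
    term : ∀ m → 𝟙 (inside i j m ∧ P m) ≡ 𝟙 (inside i j m)
    term m with inside i j m in e
    ... | false = refl
    ... | true  = cong 𝟙 (all m (inside-sound e))

gaps : ∀ {N} → Fun N → Fin N → Fin N → ℕ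
gaps w i j = count i j (λ m → inside (w i) (w j) (w m))

𝟙-three-point : ∀ {N} {x y z : Fin N} → toℕ x < toℕ y → z ≢ x → z ≢ y →
  𝟙 (x ≺ z) + 𝟙 (z ≺ y) ≡ 𝟙 (z ≺ x) + 𝟙 (y ≺ z) + 2 * 𝟙 (inside x y z)
𝟙-three-point {x = x} {y} {z} x<y z≢x z≢y with <-cmp (toℕ z) (toℕ x)
... | tri< z<x _ _
  rewrite ≺-false {p = x} {z} (<-asym z<x) | ≺-true {p = z} {y} (<-trans z<x x<y)
        | ≺-true {p = z} {x} z<x | ≺-false {p = y} {z} (<-asym (<-trans z<x x<y)) = refl
... | tri≈ _ z≡x _ = ⊥-elim (z≢x (toℕ-injective z≡x))
... | tri> _ _ x<z with <-cmp (toℕ z) (toℕ y)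
...   | tri< z<y _ _
  rewrite ≺-true {p = x} {z} x<z | ≺-true {p = z} {y} z<y | ≺-false {p = z} {x} (<-asym x<z) | ≺-false {p = y} {z} (<-asym z<y) = refl
...   | tri≈ _ z≡y _ = ⊥-elim (z≢y (toℕ-injective z≡y))
...   | tri> _ _ y<z
  rewrite ≺-true {p = x} {z} x<z | ≺-false {p = z} {y} (<-asym y<z) | ≺-false {p = z} {x} (<-asym x<z) | ≺-true {p = y} {z} y<z = refl

module _ {N : ℕ} {w : Fun N} (w-inj : Injective _≡_ _≡_ w) {i j : Fin N} (i<j : toℕ i < toℕ j) where

  private
    L R : ℕ
    L = ∑[ m < N ] 𝟙 (inside i j m ∧ w m ≺ w i) + ∑[ m < N ] 𝟙 (inside i j m ∧ w j ≺ w m)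
    R = ∑[ m < N ] 𝟙 (inside i j m ∧ w i ≺ w m) + ∑[ m < N ] 𝟙 (inside i j m ∧ w m ≺ w j)

    R≡L+2gaps : toℕ (w i) < toℕ (w j) → R ≡ L + 2 * gaps w i j
    R≡L+2gaps wi<wj = begin
      R                                       ≡⟨ ∑-distrib-+ {N} _ _ ⟨
      ∑[ m < N ] (𝟙 (inside i j m ∧ w i ≺ w m) + 𝟙 (inside i j m ∧ w m ≺ w j))
        ≡⟨ sum-cong-≗ {N} pointwise ⟩
      ∑[ m < N ] ((𝟙 (inside i j m ∧ w m ≺ w i) + 𝟙 (inside i j m ∧ w j ≺ w m))
                   + 2 * 𝟙 (inside i j m ∧ inside (w i) (w j) (w m)))
        ≡⟨ ∑-distrib-+ {N} _ _ ⟩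
      ∑[ m < N ] (𝟙 (inside i j m ∧ w m ≺ w i) + 𝟙 (inside i j m ∧ w j ≺ w m))
        + ∑[ m < N ] (2 * 𝟙 (inside i j m ∧ inside (w i) (w j) (w m)))
        ≡⟨ cong₂ _+_ (∑-distrib-+ {N} _ _) (sym (*-distribˡ-sum 2 (λ m → 𝟙 (inside i j m ∧ inside (w i) (w j) (w m))))) ⟩
      L + 2 * gaps w i j                      ∎
      where
      open ≡-Reasoning
      pointwise : ∀ m → 𝟙 (inside i j m ∧ w i ≺ w m) + 𝟙 (inside i j m ∧ w m ≺ w j)
        ≡ 𝟙 (inside i j m ∧ w m ≺ w i) + 𝟙 (inside i j m ∧ w j ≺ w m) + 2 * 𝟙 (inside i j m ∧ inside (w i) (w j) (w m))
      pointwise m with inside i j m in e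
      ... | false = refl
      ... | true  with inside-sound {i = i} {j} {m} e
      ...   | i<m , m<j = 𝟙-three-point wi<wj (λ wm≡wi → <-irrefl (cong toℕ (sym (w-inj wm≡wi))) i<m)
                                           (λ wm≡wj → <-irrefl (cong toℕ (w-inj wm≡wj)) m<j)

  len-swap-ascent : toℕ (w i) < toℕ (w j) → len (w ∘ swapF i j) ≡ len w + 1 + 2 * gaps w i j
  len-swap-ascent wi<wj = +-cancelʳ-≡ L _ _ (begin
    len (w ∘ swapF i j) + L
      ≡⟨ cong (λ b → len (w ∘ swapF i j) + (𝟙 b + L)) (≺-false {p = w j} {w i} (<-asym wi<wj)) ⟨
    len (w ∘ swapF i j) + (𝟙 (w j ≺ w i) + L)
      ≡⟨ cong (len (w ∘ swapF i j) +_) (flipped-sum i<j (λ p q → w q ≺ w p)) ⟨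
    len (w ∘ swapF i j) + ∑[ p < N ] ∑[ q < N ] 𝟙 (flipped i j p q ∧ w q ≺ w p)
      ≡⟨ len-balance w i j ⟩
    len w + ∑[ p < N ] ∑[ q < N ] 𝟙 (flipped i j p q ∧ w p ≺ w q)
      ≡⟨ cong (len w +_) (flipped-sum i<j (λ p q → w p ≺ w q)) ⟩
    len w + (𝟙 (w i ≺ w j) + R)
      ≡⟨ cong₂ (λ b r → len w + (𝟙 b + r)) (≺-true wi<wj) (R≡L+2gaps wi<wj) ⟩
    len w + (1 + (L + 2 * gaps w i j))
      ≡⟨ rearrange (len w) L (gaps w i j) ⟩
    len w + 1 + 2 * gaps w i j + L ∎)
    where
    open ≡-Reasoning
    rearrange : ∀ a l g → a + (1 + (l + 2 * g)) ≡ a + 1 + 2 * g + l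
    rearrange = solve-∀

count-cong : ∀ {N} (i j : Fin N) {P Q : Fin N → Bool} → (∀ m → Between i j m → P m ≡ Q m) → count i j P ≡ count i j Q
count-cong {N} i j {P} {Q} P≗Q = sum-cong-≗ {N} term
  where
  term : ∀ m → 𝟙 (inside i j m ∧ P m) ≡ 𝟙 (inside i j m ∧ Q m)
  term m with inside i j m in e
  ... | false = refl
  ... | true  = cong 𝟙 (P≗Q m (inside-sound e))

-- The descending case is the ascending one for w s_ij.
len-swap-descent : ∀ {N} {w : Fun N} → Injective _≡_ _≡_ w → ∀ {i j : Fin N} → toℕ i < toℕ j → toℕ (w j) < toℕ (w i) →
  len w ≡ len (w ∘ swapF i j) + 1 + 2 * count i j (λ m → inside (w j) (w i) (w m))
len-swap-descent {N} {w} w-inj {i} {j} i<j wj<wi = begin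
  len w                                    ≡⟨ len-cong (λ x → cong w (sym (swapF-involutive i j x))) ⟩
  len (y ∘ swapF i j)                      ≡⟨ len-swap-ascent y-inj i<j (subst₂ (λ a b → toℕ (w a) < toℕ (w b)) (sym (swapF-left i j)) (sym (swapF-right i j)) wj<wi) ⟩
  len y + 1 + 2 * gaps y i j               ≡⟨ cong (λ g → len y + 1 + 2 * g) (count-cong i j outside-i-j) ⟩
  len y + 1 + 2 * count i j (λ m → inside (w j) (w i) (w m)) ∎
  where
  open ≡-Reasoning
  y = w ∘ swapF i j
  y-inj : Injective _≡_ _≡_ y
  y-inj = swapF-injective i j ∘ w-inj
  outside-i-j : ∀ m → Between i j m → inside (y i) (y j) (y m) ≡ inside (w j) (w i) (w m)
  outside-i-j m (i<m , m<j) rewrite swapF-left i j | swapF-right i j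
    | swapF-other {i = i} {j} {m} (λ m≡i → <-irrefl (cong toℕ (sym m≡i)) i<m) (λ m≡j → <-irrefl (cong toℕ m≡j) m<j) = refl

-- The 1-based value w(m) of the paper, for the 0-based positions and values of Fun N.
value : ∀ {N} → Fun N → Fin N → ℕ
value w m = suc (toℕ (w m))

-- The cover condition of the k-Bruhat order: v_cd can exchange c and d across a value z iff Passable c d z.
Passable : ℕ → ℕ → ℕ → Set
Passable c d z = (c < d → ¬ (c < z × z < d)) × (d < c → d < z × z < c)

passable-ascending : ∀ {N} {x y z : Fin N} → toℕ x < toℕ y →
  Passable (suc (toℕ x)) (suc (toℕ y)) (suc (toℕ z)) ⇔ (inside x y z ≡ false)
passable-ascending {x = x} {y} {z} x<y = mk⇔ to from
  where
  to : Passable (suc (toℕ x)) (suc (toℕ y)) (suc (toℕ z)) → inside x y z ≡ false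
  to (no-between , _) with inside x y z in e
  ... | false = refl
  ... | true  with inside-sound {i = x} {y} {z} e
  ...   | x<z , z<y = ⊥-elim (no-between (s<s x<y) (s<s x<z , s<s z<y))
  from : inside x y z ≡ false → Passable (suc (toℕ x)) (suc (toℕ y)) (suc (toℕ z))
  from e = (λ _ (x<z , z<y) → true≢false (trans (sym (inside-true (s<s⁻¹ x<z , s<s⁻¹ z<y))) e))
         , (λ y<x → ⊥-elim (<-asym (s<s x<y) y<x))
    where
    true≢false : true ≢ false
    true≢false ()

passable-descending : ∀ {N} {x y z : Fin N} → toℕ y < toℕ x →
  Passable (suc (toℕ x)) (suc (toℕ y)) (suc (toℕ z)) ⇔ (inside y x z ≡ true)
passable-descending {x = x} {y} {z} y<x = mk⇔ to from
  where
  to : Passable (suc (toℕ x)) (suc (toℕ y)) (suc (toℕ z)) → inside y x z ≡ true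
  to (_ , between) with between (s<s y<x)
  ... | y<z , z<x = inside-true (s<s⁻¹ y<z , s<s⁻¹ z<x)
  from : inside y x z ≡ true → Passable (suc (toℕ x)) (suc (toℕ y)) (suc (toℕ z))
  from e with inside-sound {i = y} {x} {z} e
  ... | y<z , z<x = (λ x<y → ⊥-elim (<-asym x<y (s<s y<x))) , (λ _ → s<s y<z , s<s z<x)

module _ {N : ℕ} {w y : Fun N} (w-inj : Injective _≡_ _≡_ w) {i j : Fin N} (i<j : toℕ i < toℕ j)
         (y≗w∘s : ∀ x → y x ≡ w (swapF i j x)) where

  private
    len-y : len y ≡ len (w ∘ swapF i j)
    len-y = len-cong y≗w∘s

    wi≢wj : toℕ (w i) ≢ toℕ (w j)
    wi≢wj wi≡wj = <-irrefl (cong toℕ (w-inj (toℕ-injective wi≡wj))) i<j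

    descent-len : toℕ (w j) < toℕ (w i) → len w ≡ len y + 1 + 2 * count i j (λ m → inside (w j) (w i) (w m))
    descent-len wj<wi = trans (len-swap-descent w-inj i<j wj<wi)
      (cong (λ l → l + 1 + 2 * count i j (λ m → inside (w j) (w i) (w m))) (sym len-y))

  classical-cover : len y ≡ len w + 1 →
    value w i < value w j × (∀ m → Between i j m → Passable (value w i) (value w j) (value w m))
  classical-cover len-y≡ with <-cmp (toℕ (w i)) (toℕ (w j))
  ... | tri< wi<wj _ _ = s<s wi<wj , λ m b → Equivalence.from (passable-ascending wi<wj) (count-zero i j _ no-gaps m b)
    where
    no-gaps : gaps w i j ≡ 0
    no-gaps = m+n≡0⇒m≡0 (gaps w i j) (+-cancelˡ-≡ (len w + 1) _ 0 (begin
      len w + 1 + 2 * gaps w i j  ≡⟨ len-swap-ascent w-inj i<j wi<wj ⟨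
      len (w ∘ swapF i j)         ≡⟨ trans (sym len-y) len-y≡ ⟩
      len w + 1                   ≡⟨ +-identityʳ (len w + 1) ⟨
      len w + 1 + 0               ∎))
      where open ≡-Reasoning
  ... | tri≈ _ wi≡wj _ = ⊥-elim (wi≢wj wi≡wj)
  ... | tri> _ _ wj<wi = ⊥-elim (m≢1+m+n (len w) (begin
    len w                                         ≡⟨ descent-len wj<wi ⟩
    len y + 1 + 2 * Q                             ≡⟨ cong (λ l → l + 1 + 2 * Q) len-y≡ ⟩
    len w + 1 + 1 + 2 * Q                         ≡⟨ normalise (len w) Q ⟩
    suc (len w + suc (2 * Q))                     ∎))
    where
    open ≡-Reasoning
    Q = count i j (λ m → inside (w j) (w i) (w m))
    normalise : ∀ a q → a + 1 + 1 + 2 * q ≡ suc (a + suc (2 * q))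
    normalise = solve-∀

  classical-cover⁻¹ : value w i < value w j → (∀ m → Between i j m → Passable (value w i) (value w j) (value w m)) →
    len y ≡ len w + 1
  classical-cover⁻¹ wi<wj passable = begin
    len y                           ≡⟨ len-y ⟩
    len (w ∘ swapF i j)             ≡⟨ len-swap-ascent w-inj i<j (s<s⁻¹ wi<wj) ⟩
    len w + 1 + 2 * gaps w i j      ≡⟨ cong (λ g → len w + 1 + 2 * g) no-gaps ⟩
    len w + 1 + 0                   ≡⟨ +-identityʳ (len w + 1) ⟩
    len w + 1                       ∎
    where
    open ≡-Reasoning
    no-gaps : gaps w i j ≡ 0
    no-gaps = zero-count i j _ (λ m b → Equivalence.to (passable-ascending (s<s⁻¹ wi<wj)) (passable m b))

  quantum-cover : len y + 2 * (toℕ j ∸ toℕ i) ≡ len w + 1 →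
    value w j < value w i × (∀ m → Between i j m → Passable (value w i) (value w j) (value w m))
  quantum-cover len-y≡ with <-cmp (toℕ (w i)) (toℕ (w j))
  ... | tri< wi<wj _ _ = ⊥-elim (<-irrefl (sym no-distance) (m<n⇒0<n∸m i<j))
    where
    open ≡-Reasoning
    no-distance : toℕ j ∸ toℕ i ≡ 0
    no-distance = m+n≡0⇒m≡0 _ (m+n≡0⇒n≡0 (2 * gaps w i j) (+-cancelˡ-≡ (len w + 1) _ 0 (begin
      len w + 1 + (2 * gaps w i j + 2 * (toℕ j ∸ toℕ i))  ≡⟨ +-assoc (len w + 1) _ _ ⟨
      len w + 1 + 2 * gaps w i j + 2 * (toℕ j ∸ toℕ i)    ≡⟨ cong (_+ 2 * (toℕ j ∸ toℕ i)) (len-swap-ascent w-inj i<j wi<wj) ⟨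
      len (w ∘ swapF i j) + 2 * (toℕ j ∸ toℕ i)           ≡⟨ cong (_+ 2 * (toℕ j ∸ toℕ i)) len-y ⟨
      len y + 2 * (toℕ j ∸ toℕ i)                         ≡⟨ len-y≡ ⟩
      len w + 1                                           ≡⟨ +-identityʳ (len w + 1) ⟨
      len w + 1 + 0                                       ∎)))
  ... | tri≈ _ wi≡wj _ = ⊥-elim (wi≢wj wi≡wj)
  ... | tri> _ _ wj<wi = s<s wj<wi , λ m b → Equivalence.from (passable-descending wj<wi) (count-full i j _ full m b)
    where
    Q = count i j (λ m → inside (w j) (w i) (w m))
    full : Q ≡ toℕ j ∸ suc (toℕ i)
    full = suc-injective (trans (*-cancelˡ-≡ (suc Q) (toℕ j ∸ toℕ i) 2 (+-cancelˡ-≡ (len y) _ _ (begin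
      len y + 2 * suc Q               ≡⟨ normalise (len y) Q ⟩
      len y + 1 + 2 * Q + 1           ≡⟨ cong (_+ 1) (descent-len wj<wi) ⟨
      len w + 1                       ≡⟨ len-y≡ ⟨
      len y + 2 * (toℕ j ∸ toℕ i)     ∎))) (+-∸-assoc 1 i<j))
      where
      open ≡-Reasoning
      normalise : ∀ a q → a + 2 * suc q ≡ a + 1 + 2 * q + 1
      normalise = solve-∀

  quantum-cover⁻¹ : value w j < value w i → (∀ m → Between i j m → Passable (value w i) (value w j) (value w m)) →
    len y + 2 * (toℕ j ∸ toℕ i) ≡ len w + 1
  quantum-cover⁻¹ wj<wi passable = begin
    len y + 2 * (toℕ j ∸ toℕ i)         ≡⟨ cong (λ d → len y + 2 * d) (+-∸-assoc 1 i<j) ⟩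
    len y + 2 * suc (toℕ j ∸ suc (toℕ i)) ≡⟨ cong (λ q → len y + 2 * suc q) full ⟨
    len y + 2 * suc Q                   ≡⟨ normalise (len y) Q ⟩
    len y + 1 + 2 * Q + 1               ≡⟨ cong (_+ 1) (descent-len (s<s⁻¹ wj<wi)) ⟨
    len w + 1                           ∎
    where
    open ≡-Reasoning
    Q = count i j (λ m → inside (w j) (w i) (w m))
    full : Q ≡ toℕ j ∸ suc (toℕ i)
    full = full-count i j _ (λ m b → Equivalence.to (passable-descending (s<s⁻¹ wj<wi)) (passable m b))
    normalise : ∀ a q → a + 2 * suc q ≡ a + 1 + 2 * q + 1
    normalise = solve-∀

-- Passability and compatibility of letters

Passable? : ∀ c d z → Dec (Passable c d z)
Passable? c d z = ((c <? d) →-dec ¬? ((c <? z) ×-dec (z <? d))) ×-dec ((d <? c) →-dec ((d <? z) ×-dec (z <? c)))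

impassable-ascending : ∀ {a b z} → a < b → ¬ Passable a b z → a < z × z < b
impassable-ascending {a} {b} {z} a<b ¬p with (a <? z) ×-dec (z <? b)
... | yes a<z<b = a<z<b
... | no ¬a<z<b = ⊥-elim (¬p ((λ _ → ¬a<z<b) , (λ b<a → ⊥-elim (<-asym a<b b<a))))

impassable-descending : ∀ {a b z} → b < a → ¬ Passable a b z → ¬ (b < z × z < a)
impassable-descending b<a ¬p b<z<a = ¬p ((λ a<b → ⊥-elim (<-asym a<b b<a)) , (λ _ → b<z<a))

passable-refl : ∀ a z → Passable a a z
passable-refl a z = (λ a<a → ⊥-elim (<-irrefl refl a<a)) , (λ a<a → ⊥-elim (<-irrefl refl a<a))

private
  ≮∧≢⇒> : ∀ {x y} → ¬ x < y → y ≢ x → y < x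
  ≮∧≢⇒> x≮y y≢x = ≤∧≢⇒< (≮⇒≥ x≮y) y≢x

≢-split : ∀ {x y} → x ≢ y → x < y ⊎ y < x
≢-split {x} {y} x≢y with <-cmp x y
... | tri< x<y _ _ = inj₁ x<y
... | tri≈ _ x≡y _ = ⊥-elim (x≢y x≡y)
... | tri> _ _ y<x = inj₂ y<x

-- When v_cd exchanges c and d across a, the value replacing c is as passable for v_ab as c was.
passable-transferˡ : ∀ {a b c d} → a ≢ c → a ≢ d → Passable a b c → Passable c d a → Passable a b d
passable-transferˡ {a} {b} {c} {d} a≢c a≢d (pab-asc , pab-desc) (pcd-asc , pcd-desc) with <-cmp c d
... | tri≈ _ refl _ = pab-asc , pab-desc
... | tri< c<d _ _ =
      (λ a<b (a<d , d<b) → pab-asc a<b (≮∧≢⇒> (λ c<a → pcd-asc c<d (c<a , a<d)) a≢c , <-trans c<d d<b))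
    , (λ b<a → let b<c , c<a = pab-desc b<a in
                <-trans b<c c<d , ≮∧≢⇒> (λ a<d → pcd-asc c<d (c<a , a<d)) (a≢d ∘ sym))
... | tri> _ _ d<c =
      (λ _ (a<d , _) → <-asym a<d (proj₁ (pcd-desc d<c)))
    , (λ b<a → ⊥-elim (<-asym (proj₂ (pcd-desc d<c)) (proj₂ (pab-desc b<a))))

passable-transferʳ : ∀ {a b c d} → b ≢ c → b ≢ d → Passable a b d → Passable c d b → Passable a b c
passable-transferʳ {a} {b} {c} {d} b≢c b≢d (pab-asc , pab-desc) (pcd-asc , pcd-desc) with <-cmp c d
... | tri≈ _ refl _ = pab-asc , pab-desc
... | tri< c<d _ _ =
      (λ a<b (a<c , c<b) → pab-asc a<b (<-trans a<c c<d , ≮∧≢⇒> (λ b<d → pcd-asc c<d (c<b , b<d)) (b≢d ∘ sym)))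
    , (λ b<a → let b<d , d<a = pab-desc b<a in
                ≮∧≢⇒> (λ c<b → pcd-asc c<d (c<b , b<d)) b≢c , <-trans c<d d<a)
... | tri> _ _ d<c =
      (λ _ (_ , c<b) → <-asym c<b (proj₂ (pcd-desc d<c)))
    , (λ b<a → ⊥-elim (<-asym (proj₁ (pab-desc b<a)) (proj₁ (pcd-desc d<c))))

passable-spread : ∀ {a b c d z} → c ≢ b →
  ¬ Passable a b c → ¬ Passable a b d → Passable c d a → Passable c d b → Passable a b z → Passable c d z
passable-spread {a} {b} {c} {d} {z} c≢b ¬pc ¬pd (pcd-asc , pcd-desc) pcdb (pab-asc , pab-desc) with <-cmp a b
... | tri≈ _ refl _ = ⊥-elim (¬pc (passable-refl a c))
... | tri< a<b _ _ =
  let a<c , c<b = impassable-ascending a<b ¬pc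
      a<d , d<b = impassable-ascending a<b ¬pd
  in (λ _ (c<z , z<d) → pab-asc a<b (<-trans a<c c<z , <-trans z<d d<b))
   , (λ d<c → ⊥-elim (<-asym a<d (proj₁ (pcd-desc d<c))))
... | tri> _ _ b<a =
  let b<z , z<a = pab-desc b<a in
    (λ c<d (c<z , z<d) →
       let c<b = ≮∧≢⇒> (λ b<c → impassable-descending b<a ¬pc (b<c , <-trans c<z z<a)) c≢b
           b<d = <-trans b<z z<d
       in proj₁ pcdb c<d (c<b , b<d))
  , (λ d<c → <-trans (proj₁ (proj₂ pcdb d<c)) b<z , <-trans z<a (proj₂ (pcd-desc d<c)))

-- The letters v_cd with v_ab v_cd ≢ 0, for a, b, c, d distinct.
Compatible : ℕ → ℕ → ℕ × ℕ → Set
Compatible a b (c , d) =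
  (Passable a b c × Passable a b d) ⊎ (¬ Passable a b c × ¬ Passable a b d × Passable c d a × Passable c d b)

compatible? : ∀ a b p → Dec (Compatible a b p)
compatible? a b (c , d) =
  (Passable? a b c ×-dec Passable? a b d) ⊎-dec
  (¬? (Passable? a b c) ×-dec ¬? (Passable? a b d) ×-dec Passable? c d a ×-dec Passable? c d b)

Fresh : ℕ → ℕ → ℕ → Set
Fresh a b z = z ≢ a × z ≢ b

compatible-if-passable : ∀ {a b c d} → Fresh a b c → Fresh a b d →
  Passable c d a → Passable c d b → Compatible a b (c , d)
compatible-if-passable {a} {b} {c} {d} (c≢a , c≢b) (d≢a , d≢b) pcda pcdb with Passable? a b c | Passable? a b d
... | yes pc | yes pd = inj₁ (pc , pd)
... | yes pc | no ¬pd = ⊥-elim (¬pd (passable-transferˡ (c≢a ∘ sym) (d≢a ∘ sym) pc pcda))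
... | no ¬pc | yes pd = ⊥-elim (¬pc (passable-transferʳ (c≢b ∘ sym) (d≢b ∘ sym) pd pcdb))
... | no ¬pc | no ¬pd = inj₂ (¬pc , ¬pd , pcda , pcdb)

-- Exchanges

-- v_cd •_k w = q^β w′ ≠ 0, in terms of the 0-based positions i < k ≤ j of c and d.
record Exchange {N} (k c d : ℕ) (w w′ : Fun N) : Set where
  field
    i j      : Fin N
    i<j      : toℕ i < toℕ j
    i<k      : toℕ i < k
    k≤j      : k ≤ toℕ j
    value-i  : value w i ≡ c
    value-j  : value w j ≡ d
    swapped  : ∀ x → w′ x ≡ w (swapF i j x)
    passable : ∀ m → Between i j m → Passable c d (value w m)

  value′-i : value w′ i ≡ d
  value′-i = trans (cong (suc ∘ toℕ) (trans (swapped i) (cong w (swapF-left i j)))) value-j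

  value′-j : value w′ j ≡ c
  value′-j = trans (cong (suc ∘ toℕ) (trans (swapped j) (cong w (swapF-right i j)))) value-i

  value′-other : ∀ {m} → m ≢ i → m ≢ j → value w′ m ≡ value w m
  value′-other m≢i m≢j = cong (suc ∘ toℕ) (trans (swapped _) (cong w (swapF-other m≢i m≢j)))

  value-unmoved : ∀ {m z} → value w′ m ≡ z → z ≢ c → z ≢ d → value w m ≡ z
  value-unmoved {m} w′m≡z z≢c z≢d with locate i j m
  ... | at-left refl  = ⊥-elim (z≢d (trans (sym w′m≡z) value′-i))
  ... | at-right refl = ⊥-elim (z≢c (trans (sym w′m≡z) value′-j))
  ... | off m≢i m≢j   = trans (sym (value′-other m≢i m≢j)) w′m≡z

  injective : Injective _≡_ _≡_ w → Injective _≡_ _≡_ w′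
  injective w-inj e = swapF-injective i j (w-inj (trans (sym (swapped _)) (trans e (swapped _))))

swapF-conj : ∀ {N} {w : Fun N} → Injective _≡_ _≡_ w → ∀ i j x → w (swapF i j x) ≡ swapF (w i) (w j) (w x)
swapF-conj {w = w} w-inj i j x with locate i j x
... | at-left refl  = trans (cong w (swapF-left x j)) (sym (swapF-left (w x) (w j)))
... | at-right refl = trans (cong w (swapF-right i x)) (sym (swapF-right (w i) (w x)))
... | off x≢i x≢j   = trans (cong w (swapF-other x≢i x≢j)) (sym (swapF-other (x≢i ∘ w-inj) (x≢j ∘ w-inj)))

swapF-pair : ∀ {N} {a b x y : Fin N} → x ≢ y → swapF a b x ≡ y → (x ≡ a × y ≡ b) ⊎ (x ≡ b × y ≡ a)
swapF-pair {a = a} {b} {x} x≢y e with locate a b x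
... | at-left refl  = inj₁ (refl , trans (sym e) (swapF-left a b))
... | at-right refl = inj₂ (refl , trans (sym e) (swapF-right a b))
... | off x≢a x≢b   = ⊥-elim (x≢y (trans (sym (swapF-other x≢a x≢b)) e))

toℕ≤N∸1 : ∀ {N} (j : Fin N) → toℕ j ≤ N ∸ 1
toℕ≤N∸1 {suc n} j = toℕ≤pred[n] j

deg-cong : ∀ {N} {α β : Exps N} → (∀ m → α m ≡ β m) → deg {N} α ≡ deg {N} β
deg-cong {N} {α} {β} α≗β = trans (sum-allFin (N ∸ 1) α) (trans (sum-cong-≗ {N ∸ 1} α≗β) (sym (sum-allFin (N ∸ 1) β)))

deg-qvec : ∀ {N} {i j : Fin N} → toℕ i < toℕ j → deg {N} (qvec i j) ≡ toℕ j ∸ toℕ i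
deg-qvec {N} {i} {j} _ = trans (sum-allFin (N ∸ 1) (qvec i j)) (∑-interval (N ∸ 1) (toℕ i) (toℕ j) (toℕ≤N∸1 j))

qvec-nonzero : ∀ {N} {i j : Fin N} → toℕ i < toℕ j → ¬ (∀ m → qvec i j m ≡ 0)
qvec-nonzero {N} {i} {j} i<j qvec≡0 = 1+n≢0 (begin
  1                                          ≡⟨ cong₂ (λ b c → 𝟙 (b ∧ c)) (dec-true (toℕ i ≤? toℕ i) ≤-refl)
                                                                     (dec-true (toℕ i <? toℕ j) i<j) ⟨
  𝟙 ((toℕ i ≤ᵇ toℕ i) ∧ (toℕ i <ᵇ toℕ j))    ≡⟨ cong (λ x → 𝟙 ((toℕ i ≤ᵇ x) ∧ (x <ᵇ toℕ j))) (toℕ-fromℕ< i<N∸1) ⟨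
  qvec i j (fromℕ< i<N∸1)                    ≡⟨ qvec≡0 (fromℕ< i<N∸1) ⟩
  0                                          ∎)
  where
  open ≡-Reasoning
  i<N∸1 : toℕ i < N ∸ 1
  i<N∸1 = <-≤-trans i<j (toℕ≤N∸1 j)

module _ {N : ℕ} {k c d : ℕ} {w w′ : Fun N} (w-inj : Injective _≡_ _≡_ w) where

  private
    endpoints : ∀ {a′ b′ : Fin N} {i j} → suc (toℕ a′) ≡ c → suc (toℕ b′) ≡ d →
      (w i ≡ a′ × w j ≡ b′) ⊎ (w i ≡ b′ × w j ≡ a′) → (value w i ≡ c × value w j ≡ d) ⊎ (value w i ≡ d × value w j ≡ c)
    endpoints a′↦c b′↦d (inj₁ (refl , refl)) = inj₁ (a′↦c , b′↦d)
    endpoints a′↦c b′↦d (inj₂ (refl , refl)) = inj₂ (b′↦d , a′↦c)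

    cover-endpoints : ∀ {a′ b′ i j} → suc (toℕ a′) ≡ c → suc (toℕ b′) ≡ d → toℕ i < toℕ j →
      (∀ x → w′ x ≡ swapF a′ b′ (w x)) → (∀ x → w′ x ≡ w (swapF i j x)) →
      (value w i ≡ c × value w j ≡ d) ⊎ (value w i ≡ d × value w j ≡ c)
    cover-endpoints {i = i} {j} a′↦c b′↦d i<j w′≗ y≗ =
      endpoints a′↦c b′↦d (swapF-pair wi≢wj (trans (sym (w′≗ i)) (trans (y≗ i) (cong w (swapF-left i j)))))
      where
      wi≢wj : w i ≢ w j
      wi≢wj wi≡wj = <-irrefl (cong toℕ (w-inj wi≡wj)) i<j

    mk-exchange : ∀ {i j} → toℕ i < toℕ j → toℕ i < k → k ≤ toℕ j → (∀ x → w′ x ≡ w (swapF i j x)) →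
      value w i ≡ c → value w j ≡ d → (∀ m → Between i j m → Passable (value w i) (value w j) (value w m)) →
      Exchange k c d w w′
    mk-exchange {i} {j} i<j i<k k≤j y≗ wi↦c wj↦d passable = record
      { i = i ; j = j ; i<j = i<j ; i<k = i<k ; k≤j = k≤j ; value-i = wi↦c ; value-j = wj↦d ; swapped = y≗
      ; passable = λ m b → subst₂ (λ c d → Passable c d (value w m)) wi↦c wj↦d (passable m b) }

  step→exchange : ∀ {β} → Step k c d w β w′ → Exchange k c d w w′
  step→exchange (a′ , b′ , a′↦c , b′↦d , w′≗ , inj₁ (c<d , β≡0 , i , j , i<j , i<k , k<1+j , y≗ , inj₁ (_ , len≡)))
    with classical-cover w-inj i<j y≗ len≡ | cover-endpoints a′↦c b′↦d i<j w′≗ y≗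
  ... | _     , passable | inj₁ (wi↦c , wj↦d) = mk-exchange i<j i<k (s≤s⁻¹ k<1+j) y≗ wi↦c wj↦d passable
  ... | wi<wj , _        | inj₂ (wi↦d , wj↦c) = ⊥-elim (<-asym c<d (subst₂ _<_ wi↦d wj↦c wi<wj))
  step→exchange (_ , _ , _ , _ , _ , inj₁ (_ , β≡0 , i , j , i<j , _ , _ , _ , inj₂ (β≡q , _))) =
    ⊥-elim (qvec-nonzero i<j (λ m → trans (sym (β≡q m)) (β≡0 m)))
  step→exchange (_ , _ , _ , _ , _ , inj₂ (_ , i , j , _ , _ , i<j , β≡q , _ , _ , _ , _ , _ , _ , inj₁ (β≡0 , _))) =
    ⊥-elim (qvec-nonzero i<j (λ m → trans (sym (β≡q m)) (β≡0 m)))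
  step→exchange (a′ , b′ , a′↦c , b′↦d , w′≗ , inj₂ (d<c , _ , _ , _ , _ , _ , _ , i , j , i<j , i<k , k<1+j , y≗ , inj₂ (β≡q , lenq≡)))
    with quantum-cover w-inj i<j y≗ len≡ | cover-endpoints a′↦c b′↦d i<j w′≗ y≗
    where
    len≡ : len w′ + 2 * (toℕ j ∸ toℕ i) ≡ len w + 1
    len≡ = trans (cong (λ D → len w′ + 2 * D) (sym (trans (deg-cong {N} β≡q) (deg-qvec i<j)))) lenq≡
  ... | _     , passable | inj₁ (wi↦c , wj↦d) = mk-exchange i<j i<k (s≤s⁻¹ k<1+j) y≗ wi↦c wj↦d passable
  ... | wj<wi , _        | inj₂ (wi↦d , wj↦c) = ⊥-elim (<-asym d<c (subst₂ _<_ wj↦c wi↦d wj<wi))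

  exchange→step : Exchange k c d w w′ → Σ (Exps N) λ β → Step k c d w β w′
  exchange→step e = oriented (<-cmp c d)
    where
    open Exchange e
    w′≗swap : ∀ x → w′ x ≡ swapF (w i) (w j) (w x)
    w′≗swap x = trans (swapped x) (swapF-conj w-inj i j x)
    passable′ : ∀ m → Between i j m → Passable (value w i) (value w j) (value w m)
    passable′ m b = subst₂ (λ c d → Passable c d (value w m)) (sym value-i) (sym value-j) (passable m b)
    oriented : Tri (c < d) (c ≡ d) (d < c) → Σ (Exps N) λ β → Step k c d w β w′
    oriented (tri< c<d _ _) = (λ _ → 0) , w i , w j , value-i , value-j , w′≗swap ,
      inj₁ (c<d , (λ _ → refl) , i , j , i<j , i<k , s≤s k≤j , swapped , inj₁ ((λ _ → refl) ,
        classical-cover⁻¹ w-inj i<j swapped (subst₂ _<_ (sym value-i) (sym value-j) c<d) passable′))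
    oriented (tri≈ _ c≡d _) =
      ⊥-elim (<-irrefl (cong toℕ (w-inj (toℕ-injective (suc-injective (trans value-i (trans c≡d (sym value-j))))))) i<j)
    oriented (tri> _ _ d<c) = qvec i j , w i , w j , value-i , value-j , w′≗swap ,
      inj₂ (d<c , i , j , refl , refl , i<j , (λ _ → refl) , i , j , i<j , i<k , s≤s k≤j , swapped , inj₂ ((λ _ → refl) ,
        trans (cong (λ D → len w′ + 2 * D) (deg-qvec i<j))
              (quantum-cover⁻¹ w-inj i<j swapped (subst₂ _<_ (sym value-j) (sym value-i) d<c) passable′)))

-- Runs of exchanges; the rightmost letter acts first.
data Exchanges {N} (k : ℕ) (w₀ : Fun N) : Word → Fun N → Set where
  start : ∀ {w} → (∀ x → w x ≡ w₀ x) → Exchanges k w₀ [] w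
  _◅_   : ∀ {c d v w₁ w} → Exchange k c d w₁ w → Exchanges k w₀ v w₁ → Exchanges k w₀ ((c , d) ∷ v) w

exchanges-injective : ∀ {N k} {w₀ w : Fun N} {v} → Injective _≡_ _≡_ w₀ → Exchanges k w₀ v w → Injective _≡_ _≡_ w
exchanges-injective w₀-inj (start w≗w₀) e = w₀-inj (trans (sym (w≗w₀ _)) (trans e (w≗w₀ _)))
exchanges-injective w₀-inj (e ◅ es)     = Exchange.injective e (exchanges-injective w₀-inj es)

run→exchanges : ∀ {N k v α γ} {u y : Fun N} → Injective _≡_ _≡_ u → Run k v α u γ y → Exchanges k u v y
run→exchanges {v = []}    u-inj (_ , y≗u)                     = start y≗u
run→exchanges {v = _ ∷ _} u-inj (_ , _ , run , _ , step , _) =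
  step→exchange (exchanges-injective u-inj es) step ◅ es
  where es = run→exchanges u-inj run

permutation-injective : ∀ {N} (u : Permutation′ N) → Injective _≡_ _≡_ (u ⟨$⟩ʳ_)
permutation-injective u e = trans (sym (Perm.inverseˡ u)) (trans (cong (u ⟨$⟩ˡ_) e) (Perm.inverseˡ u))

-- Vanishing of v_ab v when some letter of v is incompatible with v_ab

Blocked : ∀ {N} → ℕ → ℕ → Fin N → Fin N → Fun N → Set
Blocked {N} a b Pa Pb w = Σ (Fin N) λ m → Between Pa Pb m × ¬ Passable a b (value w m)

module _ {N k a b : ℕ} {Pa Pb : Fin N} (Pa<k : toℕ Pa < k) (k≤Pb : k ≤ toℕ Pb) where

  module _ {c d : ℕ} {w w′ : Fun N} (e : Exchange k c d w w′) (fc : Fresh a b c) (fd : Fresh a b d)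
           (w-Pa : value w Pa ≡ a) (w-Pb : value w Pb ≡ b) where
    open Exchange e

    private
      c≢a = proj₁ fc
      c≢b = proj₂ fc
      d≢a = proj₁ fd
      d≢b = proj₂ fd

      i≢Pa : toℕ i ≢ toℕ Pa
      i≢Pa i≡Pa = c≢a (trans (sym value-i) (trans (cong (value w) (toℕ-injective i≡Pa)) w-Pa))

      Pb≢j : toℕ Pb ≢ toℕ j
      Pb≢j Pb≡j = d≢b (trans (sym value-j) (trans (cong (value w) (toℕ-injective (sym Pb≡j))) w-Pb))

      passable-a : toℕ i < toℕ Pa → Passable c d a
      passable-a i<Pa = subst (Passable c d) w-Pa (passable Pa (i<Pa , <-≤-trans Pa<k k≤j))

      passable-b : toℕ Pb < toℕ j → Passable c d b
      passable-b Pb<j = subst (Passable c d) w-Pb (passable Pb (<-≤-trans i<k k≤Pb , Pb<j))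

      blocked-at-i : toℕ Pa < toℕ i → ¬ Passable a b d → Blocked a b Pa Pb w′
      blocked-at-i Pa<i ¬pd = i , (Pa<i , <-≤-trans i<k k≤Pb) , subst (¬_ ∘ Passable a b) (sym value′-i) ¬pd

      blocked-at-j : toℕ j < toℕ Pb → ¬ Passable a b c → Blocked a b Pa Pb w′
      blocked-at-j j<Pb ¬pc = j , (<-≤-trans Pa<k k≤j , j<Pb) , subst (¬_ ∘ Passable a b) (sym value′-j) ¬pc

      transferˡ : Passable a b c → Passable c d a → Passable a b d
      transferˡ = passable-transferˡ (c≢a ∘ sym) (d≢a ∘ sym)

      transferʳ : Passable a b d → Passable c d b → Passable a b c
      transferʳ = passable-transferʳ (c≢b ∘ sym) (d≢b ∘ sym)

    blocked-created : ¬ Compatible a b (c , d) → Blocked a b Pa Pb w′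
    blocked-created ¬compatible with ≢-split i≢Pa | ≢-split Pb≢j
    ... | inj₂ Pa<i | inj₂ j<Pb with Passable? a b c | Passable? a b d
    ...   | no ¬pc | _      = blocked-at-j j<Pb ¬pc
    ...   | yes _  | no ¬pd = blocked-at-i Pa<i ¬pd
    ...   | yes pc | yes pd = ⊥-elim (¬compatible (inj₁ (pc , pd)))
    blocked-created ¬compatible | inj₁ i<Pa | inj₂ j<Pb with Passable? a b c
    ...   | no ¬pc = blocked-at-j j<Pb ¬pc
    ...   | yes pc = ⊥-elim (¬compatible (inj₁ (pc , transferˡ pc (passable-a i<Pa))))
    blocked-created ¬compatible | inj₂ Pa<i | inj₁ Pb<j with Passable? a b d
    ...   | no ¬pd = blocked-at-i Pa<i ¬pd
    ...   | yes pd = ⊥-elim (¬compatible (inj₁ (transferʳ pd (passable-b Pb<j) , pd)))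
    blocked-created ¬compatible | inj₁ i<Pa | inj₁ Pb<j =
      ⊥-elim (¬compatible (compatible-if-passable fc fd (passable-a i<Pa) (passable-b Pb<j)))

    blocked-preserved : Blocked a b Pa Pb w → Blocked a b Pa Pb w′
    blocked-preserved (m , m-between , ¬pm) with locate i j m
    ... | at-left refl with ≢-split Pb≢j
    ...   | inj₂ j<Pb = blocked-at-j j<Pb ¬pc
      where ¬pc = subst (¬_ ∘ Passable a b) value-i ¬pm
    ...   | inj₁ Pb<j = blocked-at-i (proj₁ m-between) (λ pd → ¬pc (transferʳ pd (passable-b Pb<j)))
      where ¬pc = subst (¬_ ∘ Passable a b) value-i ¬pm
    blocked-preserved (m , m-between , ¬pm) | at-right refl with ≢-split i≢Pa
    ...   | inj₂ Pa<i = blocked-at-i Pa<i ¬pd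
      where ¬pd = subst (¬_ ∘ Passable a b) value-j ¬pm
    ...   | inj₁ i<Pa = blocked-at-j (proj₂ m-between) (λ pc → ¬pd (transferˡ pc (passable-a i<Pa)))
      where ¬pd = subst (¬_ ∘ Passable a b) value-j ¬pm
    blocked-preserved (m , m-between , ¬pm) | off m≢i m≢j =
      m , m-between , subst (¬_ ∘ Passable a b) (sym (value′-other m≢i m≢j)) ¬pm

  blocked-along : ∀ {v} {w₀ w : Fun N} → Exchanges k w₀ v w → All (Fresh a b) (support v) →
    value w Pa ≡ a → value w Pb ≡ b → Any (¬_ ∘ Compatible a b) v → Blocked a b Pa Pb w
  blocked-along (e ◅ es) (fc ∷ fd ∷ fresh) w-Pa w-Pb = blocked
    where
    w₁-Pa = Exchange.value-unmoved e w-Pa (proj₁ fc ∘ sym) (proj₁ fd ∘ sym)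
    w₁-Pb = Exchange.value-unmoved e w-Pb (proj₂ fc ∘ sym) (proj₂ fd ∘ sym)
    blocked : Any (¬_ ∘ Compatible a b) _ → Blocked a b Pa Pb _
    blocked (here ¬compatible)   = blocked-created e fc fd w₁-Pa w₁-Pb ¬compatible
    blocked (there incompatible) = blocked-preserved e fc fd w₁-Pa w₁-Pb (blocked-along es fresh w₁-Pa w₁-Pb incompatible)

incompatible⇒zero : ∀ {a b} (v : Word) → All (Fresh a b) (support v) → Any (¬_ ∘ Compatible a b) v → IsZero ((a , b) ∷ v)
incompatible⇒zero v fresh incompatible N _ _ u k _ _ (_ , _ , _ , _ , run , _ , step , _) =
  let m , m-between , ¬passable = blocked-along i<k k≤j es fresh value-i value-j incompatible
  in ¬passable (passable m m-between)
  where
  es = run→exchanges (permutation-injective u) run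
  open Exchange (step→exchange (exchanges-injective (permutation-injective u) es) step)

-- Configurations: the values left and right of the wall

Cfg : Set
Cfg = List ℕ × List ℕ

line : Cfg → List ℕ
line (L , R) = L ++ R

wall : Cfg → ℕ
wall (L , R) = length L

data _⟶⟨_⟩_ : Cfg → ℕ × ℕ → Cfg → Set where
  exchange : ∀ {c d} A B₁ B₂ C → All (Passable c d) (B₁ ++ B₂) →
             (A ++ c ∷ B₁ , B₂ ++ d ∷ C) ⟶⟨ c , d ⟩ (A ++ d ∷ B₁ , B₂ ++ c ∷ C)

exchange-≡ : ∀ {c d L R L′ R′} A B₁ B₂ C →
  L ≡ A ++ c ∷ B₁ → R ≡ B₂ ++ d ∷ C → L′ ≡ A ++ d ∷ B₁ → R′ ≡ B₂ ++ c ∷ C → All (Passable c d) (B₁ ++ B₂) →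
  (L , R) ⟶⟨ c , d ⟩ (L′ , R′)
exchange-≡ A B₁ B₂ C refl refl refl refl = exchange A B₁ B₂ C

data _⟶⋆⟨_⟩_ : Cfg → Word → Cfg → Set where
  []  : ∀ {κ} → κ ⟶⋆⟨ [] ⟩ κ
  _◅_ : ∀ {κ₀ κ₁ κ₂ p v} → κ₁ ⟶⟨ p ⟩ κ₂ → κ₀ ⟶⋆⟨ v ⟩ κ₁ → κ₀ ⟶⋆⟨ p ∷ v ⟩ κ₂

module _ {P : ℕ → Set} (P? : Decidable P) where

  filter-accept-mid : ∀ {c} A B → P c → filter P? (A ++ c ∷ B) ≡ filter P? A ++ c ∷ filter P? B
  filter-accept-mid A B pc = trans (filter-++ P? A _) (cong (filter P? A ++_) (filter-accept P? pc))

  filter-reject-mid : ∀ {c} A B → ¬ P c → filter P? (A ++ c ∷ B) ≡ filter P? A ++ filter P? B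
  filter-reject-mid A B ¬pc = trans (filter-++ P? A _) (cong (filter P? A ++_) (filter-reject P? ¬pc))

  filter-passable : ∀ {c d} B₁ B₂ → All (Passable c d) (B₁ ++ B₂) → All (Passable c d) (filter P? B₁ ++ filter P? B₂)
  filter-passable B₁ B₂ pass = ++⁺ (filter⁺ P? (++⁻ˡ B₁ pass)) (filter⁺ P? (++⁻ʳ B₁ pass))

  filter-cfg : Cfg → Cfg
  filter-cfg (L , R) = filter P? L , filter P? R

  filter-moves : ∀ {v κ κ′} → All P (support v) → κ ⟶⋆⟨ v ⟩ κ′ → filter-cfg κ ⟶⋆⟨ v ⟩ filter-cfg κ′
  filter-moves _ [] = []
  filter-moves (pc ∷ pd ∷ p-support) (exchange A B₁ B₂ C pass ◅ run) =
    exchange-≡ (filter P? A) (filter P? B₁) (filter P? B₂) (filter P? C)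
      (filter-accept-mid A B₁ pc) (filter-accept-mid B₂ C pd) (filter-accept-mid A B₁ pd) (filter-accept-mid B₂ C pc)
      (filter-passable B₁ B₂ pass)
    ◅ filter-moves p-support run

-- Making room for v_ab

module Layout (a b : ℕ) (E : List ℕ) where

  private
    G? : Decidable (Passable a b)
    G? = Passable? a b

    ¬G? : Decidable (¬_ ∘ Passable a b)
    ¬G? = ∁? G?

  lay : Cfg → Cfg
  lay (L , R) = E ++ filter ¬G? L ++ a ∷ filter G? L , filter G? R ++ b ∷ filter ¬G? R

  lay-move : ∀ {c d κ κ′} → Compatible a b (c , d) → c ≢ b → κ ⟶⟨ c , d ⟩ κ′ → lay κ ⟶⟨ c , d ⟩ lay κ′
  lay-move {c} {d} (inj₁ (pc , pd)) _ (exchange A B₁ B₂ C pass) =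
    exchange-≡ (E ++ (filter ¬G? A ++ filter ¬G? B₁) ++ a ∷ filter G? A) (filter G? B₁)
               (filter G? B₂) (filter G? C ++ b ∷ filter ¬G? (B₂ ++ d ∷ C))
      (left pc) right (left pd)
      (trans (cong₂ (λ X Y → X ++ b ∷ Y) (filter-accept-mid G? B₂ C pc)
                    (trans (filter-reject-mid ¬G? B₂ C (λ ¬pc → ¬pc pc)) (sym (filter-reject-mid ¬G? B₂ C (λ ¬pd → ¬pd pd)))))
             (++-assoc (filter G? B₂) (c ∷ filter G? C) _))
      (filter-passable G? B₁ B₂ pass)
    where
    left : ∀ {x} → Passable a b x →
      E ++ filter ¬G? (A ++ x ∷ B₁) ++ a ∷ filter G? (A ++ x ∷ B₁)
        ≡ (E ++ (filter ¬G? A ++ filter ¬G? B₁) ++ a ∷ filter G? A) ++ x ∷ filter G? B₁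
    left {x} px rewrite filter-reject-mid ¬G? A B₁ (λ ¬px → ¬px px) | filter-accept-mid G? A B₁ px =
      sym (trans (++-assoc E _ (x ∷ filter G? B₁)) (cong (E ++_) (++-assoc (filter ¬G? A ++ filter ¬G? B₁) (a ∷ filter G? A) _)))
    right : filter G? (B₂ ++ d ∷ C) ++ b ∷ filter ¬G? (B₂ ++ d ∷ C)
              ≡ filter G? B₂ ++ d ∷ (filter G? C ++ b ∷ filter ¬G? (B₂ ++ d ∷ C))
    right rewrite filter-accept-mid G? B₂ C pd = ++-assoc (filter G? B₂) (d ∷ filter G? C) _
  lay-move {c} {d} (inj₂ (¬pc , ¬pd , pca , pcb)) c≢b (exchange A B₁ B₂ C pass) =
    exchange-≡ (E ++ filter ¬G? A) (filter ¬G? B₁ ++ a ∷ filter G? (A ++ c ∷ B₁))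
               (filter G? (B₂ ++ d ∷ C) ++ b ∷ filter ¬G? B₂) (filter ¬G? C)
      (left ¬pc) (right ¬pd)
      (trans (cong (λ X → E ++ filter ¬G? (A ++ d ∷ B₁) ++ a ∷ X) same-G-left) (left ¬pd))
      (trans (cong (λ X → X ++ b ∷ filter ¬G? (B₂ ++ c ∷ C)) (sym same-G-right)) (right ¬pc))
      (++⁺ (++⁺ (filter⁺ ¬G? (++⁻ˡ B₁ pass)) (pca ∷ spread (A ++ c ∷ B₁)))
           (++⁺ (spread (B₂ ++ d ∷ C)) (pcb ∷ filter⁺ ¬G? (++⁻ʳ B₁ pass))))
    where
    spread : ∀ X → All (Passable c d) (filter G? X)
    spread X = All.map (passable-spread c≢b ¬pc ¬pd pca pcb) (all-filter G? X)
    same-G-left : filter G? (A ++ d ∷ B₁) ≡ filter G? (A ++ c ∷ B₁)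
    same-G-left = trans (filter-reject-mid G? A B₁ ¬pd) (sym (filter-reject-mid G? A B₁ ¬pc))
    same-G-right : filter G? (B₂ ++ d ∷ C) ≡ filter G? (B₂ ++ c ∷ C)
    same-G-right = trans (filter-reject-mid G? B₂ C ¬pd) (sym (filter-reject-mid G? B₂ C ¬pc))
    left : ∀ {x} → ¬ Passable a b x →
      E ++ filter ¬G? (A ++ x ∷ B₁) ++ a ∷ filter G? (A ++ c ∷ B₁)
        ≡ (E ++ filter ¬G? A) ++ x ∷ (filter ¬G? B₁ ++ a ∷ filter G? (A ++ c ∷ B₁))
    left {x} ¬px rewrite filter-accept-mid ¬G? A B₁ ¬px =
      trans (cong (E ++_) (++-assoc (filter ¬G? A) (x ∷ filter ¬G? B₁) _)) (sym (++-assoc E (filter ¬G? A) _))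
    right : ∀ {x} → ¬ Passable a b x →
      filter G? (B₂ ++ d ∷ C) ++ b ∷ filter ¬G? (B₂ ++ x ∷ C)
        ≡ (filter G? (B₂ ++ d ∷ C) ++ b ∷ filter ¬G? B₂) ++ x ∷ filter ¬G? C
    right {x} ¬px rewrite filter-accept-mid ¬G? B₂ C ¬px = sym (++-assoc (filter G? (B₂ ++ d ∷ C)) (b ∷ filter ¬G? B₂) _)

  lay-moves : ∀ {v κ κ′} → All (Compatible a b) v → All (Fresh a b) (support v) → κ ⟶⋆⟨ v ⟩ κ′ → lay κ ⟶⋆⟨ v ⟩ lay κ′
  lay-moves _ _ [] = []
  lay-moves (compatible ∷ compatibles) ((_ , c≢b) ∷ _ ∷ fresh) (step ◅ run) =
    lay-move compatible c≢b step ◅ lay-moves compatibles fresh run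

  lay-final : ∀ κ → Σ Cfg λ κ′ → lay κ ⟶⟨ a , b ⟩ κ′
  lay-final (L , R) = _ , exchange-≡ (E ++ filter ¬G? L) (filter G? L) (filter G? R) (filter ¬G? R)
    (sym (++-assoc E _ _)) refl refl refl (++⁺ (all-filter G? L) (all-filter G? R))

-- From positions to configurations

segment : (ℕ → ℕ) → ℕ → ℕ → List ℕ
segment F s zero    = []
segment F s (suc n) = F s ∷ segment F (suc s) n

private
  shift-bound : ∀ {s n x} → x < suc s + n → x < s + suc n
  shift-bound {s} {n} {x} = subst (x <_) (sym (+-suc s n))

length-segment : ∀ F s n → length (segment F s n) ≡ n
length-segment F s zero    = refl
length-segment F s (suc n) = cong suc (length-segment F (suc s) n)

segment-++ : ∀ F s m n → segment F s (m + n) ≡ segment F s m ++ segment F (s + m) n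
segment-++ F s zero    n = cong (λ t → segment F t n) (sym (+-identityʳ s))
segment-++ F s (suc m) n = cong (F s ∷_) (trans (segment-++ F (suc s) m n) (cong (λ t → segment F (suc s) m ++ segment F t n) (sym (+-suc s m))))

segment-cong : ∀ {F G} s n → (∀ x → s ≤ x → x < s + n → F x ≡ G x) → segment F s n ≡ segment G s n
segment-cong s zero    F≗G = refl
segment-cong s (suc n) F≗G =
  cong₂ _∷_ (F≗G s ≤-refl (m<m+n s z<s)) (segment-cong (suc s) n (λ x s<x x<s+n → F≗G x (<⇒≤ s<x) (shift-bound x<s+n)))

segment-All : ∀ {P : ℕ → Set} F s n → (∀ x → s ≤ x → x < s + n → P (F x)) → All P (segment F s n)
segment-All F s zero    p = []
segment-All F s (suc n) p = p s ≤-refl (m<m+n s z<s) ∷ segment-All F (suc s) n (λ x s<x x<s+n → p x (<⇒≤ s<x) (shift-bound x<s+n))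

segment-∈ : ∀ F s n {z} → z ∈ segment F s n → Σ ℕ λ x → s ≤ x × x < s + n × F x ≡ z
segment-∈ F s (suc n) (here z≡Fs) = s , ≤-refl , m<m+n s z<s , sym z≡Fs
segment-∈ F s (suc n) (there z∈)  with segment-∈ F (suc s) n z∈
... | x , s<x , x<s+n , Fx≡z = x , <⇒≤ s<x , shift-bound x<s+n , Fx≡z

segment-∋ : ∀ F s n {x} → s ≤ x → x < s + n → F x ∈ segment F s n
segment-∋ F s zero    {x} s≤x x<s+0 = ⊥-elim (<-irrefl refl (<-≤-trans x<s+0 (subst (_≤ x) (sym (+-identityʳ s)) s≤x)))
segment-∋ F s (suc n) {x} s≤x x<s+n with m≤n⇒m<n∨m≡n s≤x
... | inj₁ s<x  = there (segment-∋ F (suc s) n s<x (subst (x <_) (+-suc s n) x<s+n))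
... | inj₂ refl = here refl

segment-split : ∀ F s n {p} → s ≤ p → p < s + n →
  segment F s n ≡ segment F s (p ∸ s) ++ F p ∷ segment F (suc p) (s + n ∸ suc p)
segment-split F s n {p} s≤p p<s+n = begin
  segment F s n                                                ≡⟨ cong (segment F s) n≡ ⟩
  segment F s ((p ∸ s) + suc (s + n ∸ suc p))                  ≡⟨ segment-++ F s (p ∸ s) _ ⟩
  segment F s (p ∸ s) ++ segment F (s + (p ∸ s)) (suc (s + n ∸ suc p))
    ≡⟨ cong (λ t → segment F s (p ∸ s) ++ segment F t (suc (s + n ∸ suc p))) (m+[n∸m]≡n s≤p) ⟩
  segment F s (p ∸ s) ++ F p ∷ segment F (suc p) (s + n ∸ suc p) ∎
  where
  open ≡-Reasoning
  n≡ : n ≡ (p ∸ s) + suc (s + n ∸ suc p)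
  n≡ = +-cancelˡ-≡ s n _ (begin
    s + n                                   ≡⟨ m+[n∸m]≡n p<s+n ⟨
    suc p + (s + n ∸ suc p)                 ≡⟨ +-suc p _ ⟨
    p + suc (s + n ∸ suc p)                 ≡⟨ cong (_+ suc (s + n ∸ suc p)) (m+[n∸m]≡n s≤p) ⟨
    s + (p ∸ s) + suc (s + n ∸ suc p)       ≡⟨ +-assoc s (p ∸ s) _ ⟩
    s + ((p ∸ s) + suc (s + n ∸ suc p))     ∎)

valueAt : ∀ {N} → Fun N → ℕ → ℕ
valueAt {N} w x with x <? N
... | yes x<N = value w (fromℕ< x<N)
... | no _    = 0

valueAt-toℕ : ∀ {N} (w : Fun N) m → valueAt w (toℕ m) ≡ value w m
valueAt-toℕ {N} w m with toℕ m <? N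
... | yes m<N = cong (value w) (fromℕ<-toℕ m m<N)
... | no m≮N  = ⊥-elim (m≮N (toℕ<n m))

valueAt-fromℕ< : ∀ {N} (w : Fun N) {x} (x<N : x < N) → valueAt w x ≡ value w (fromℕ< x<N)
valueAt-fromℕ< w {x} x<N = trans (cong (valueAt w) (sym (toℕ-fromℕ< x<N))) (valueAt-toℕ w (fromℕ< x<N))

cfg : ∀ {N} → ℕ → Fun N → Cfg
cfg {N} k w = segment (valueAt w) 0 k , segment (valueAt w) k (N ∸ k)

cfg-cong : ∀ {N} k {w w′ : Fun N} → (∀ x → w x ≡ w′ x) → cfg k w ≡ cfg k w′
cfg-cong {N} k {w} {w′} w≗w′ = cong₂ _,_ (segment-cong 0 k (λ x _ _ → same x)) (segment-cong k (N ∸ k) (λ x _ _ → same x))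
  where
  same : ∀ x → valueAt w x ≡ valueAt w′ x
  same x with x <? N
  ... | yes x<N = cong (suc ∘ toℕ) (w≗w′ (fromℕ< x<N))
  ... | no _    = refl

module _ {N k c d : ℕ} {w w′ : Fun N} (e : Exchange k c d w w′) where
  open Exchange e

  segment-unmoved : ∀ s n → (∀ x → s ≤ x → x < s + n → x ≢ toℕ i × x ≢ toℕ j) →
    segment (valueAt w′) s n ≡ segment (valueAt w) s n
  segment-unmoved s n avoids = segment-cong s n (λ x s≤x x<s+n → unmoved x (avoids x s≤x x<s+n))
    where
    unmoved : ∀ x → x ≢ toℕ i × x ≢ toℕ j → valueAt w′ x ≡ valueAt w x
    unmoved x (x≢i , x≢j) with x <? N
    ... | yes x<N = value′-other (λ m≡i → x≢i (trans (sym (toℕ-fromℕ< x<N)) (cong toℕ m≡i)))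
                                 (λ m≡j → x≢j (trans (sym (toℕ-fromℕ< x<N)) (cong toℕ m≡j)))
    ... | no _    = refl

  valueAt-passable : ∀ x → toℕ i < x → x < toℕ j → Passable c d (valueAt w x)
  valueAt-passable x i<x x<j = subst (Passable c d) (sym (valueAt-fromℕ< w x<N))
    (passable (fromℕ< x<N) (subst (toℕ i <_) (sym (toℕ-fromℕ< x<N)) i<x , subst (_< toℕ j) (sym (toℕ-fromℕ< x<N)) x<j))
    where
    x<N : x < N
    x<N = <-trans x<j (toℕ<n j)

  exchange→move : cfg k w ⟶⟨ c , d ⟩ cfg k w′
  exchange→move = exchange-≡ A B₁ B₂ C
    (trans (segment-split F 0 k z≤n i<k) (cong (λ z → A ++ z ∷ B₁) (trans (valueAt-toℕ w i) value-i)))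
    (trans (segment-split F k (N ∸ k) k≤j j<k+[N∸k]) (cong (λ z → B₂ ++ z ∷ C) (trans (valueAt-toℕ w j) value-j)))
    (trans (segment-split F′ 0 k z≤n i<k)
      (cong₂ _++_ (segment-unmoved 0 (toℕ i) (λ x _ x<i → <⇒≢ x<i , <⇒≢ (<-trans x<i i<j)))
        (cong₂ _∷_ (trans (valueAt-toℕ w′ i) value′-i)
          (segment-unmoved (suc (toℕ i)) (k ∸ suc (toℕ i)) (λ x i<x x<k → >⇒≢ i<x , <⇒≢ (B₁-below-j x<k))))))
    (trans (segment-split F′ k (N ∸ k) k≤j j<k+[N∸k])
      (cong₂ _++_ (segment-unmoved k (toℕ j ∸ k) (λ x k≤x x<j → >⇒≢ (<-≤-trans i<k k≤x) , <⇒≢ (B₂-below-j x<j)))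
        (cong₂ _∷_ (trans (valueAt-toℕ w′ j) value′-j)
          (segment-unmoved (suc (toℕ j)) (k + (N ∸ k) ∸ suc (toℕ j)) (λ x j<x _ → >⇒≢ (<-trans i<j j<x) , >⇒≢ j<x)))))
    (++⁺ (segment-All F (suc (toℕ i)) (k ∸ suc (toℕ i)) (λ x i<x x<k → valueAt-passable x i<x (B₁-below-j x<k)))
         (segment-All F k (toℕ j ∸ k) (λ x k≤x x<j → valueAt-passable x (<-≤-trans i<k k≤x) (B₂-below-j x<j))))
    where
    F F′ : ℕ → ℕ
    F = valueAt w
    F′ = valueAt w′
    A B₁ B₂ C : List ℕ
    A  = segment F 0 (toℕ i)
    B₁ = segment F (suc (toℕ i)) (k ∸ suc (toℕ i))
    B₂ = segment F k (toℕ j ∸ k)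
    C  = segment F (suc (toℕ j)) (k + (N ∸ k) ∸ suc (toℕ j))
    B₁-below-j : ∀ {x} → x < suc (toℕ i) + (k ∸ suc (toℕ i)) → x < toℕ j
    B₁-below-j {x} x<k = <-≤-trans (subst (x <_) (m+[n∸m]≡n i<k) x<k) k≤j
    B₂-below-j : ∀ {x} → x < k + (toℕ j ∸ k) → x < toℕ j
    B₂-below-j {x} = subst (x <_) (m+[n∸m]≡n k≤j)
    j<k+[N∸k] : toℕ j < k + (N ∸ k)
    j<k+[N∸k] = subst (toℕ j <_) (sym (m+[n∸m]≡n (≤-trans k≤j (<⇒≤ (toℕ<n j))))) (toℕ<n j)

exchanges→moves : ∀ {N k v} {w₀ w : Fun N} → Exchanges k w₀ v w → cfg k w₀ ⟶⋆⟨ v ⟩ cfg k w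
exchanges→moves {k = k} {w₀ = w₀} (start w≗w₀) = subst (cfg k w₀ ⟶⋆⟨ [] ⟩_) (cfg-cong k (sym ∘ w≗w₀)) []
exchanges→moves (e ◅ es) = exchange→move e ◅ exchanges→moves es

Exact : ℕ → List ℕ → Set
Exact N l = Unique l × All (InRange N) l × (∀ z → InRange N z → z ∈ l)

segment-unique : ∀ F s n → (∀ {x y} → s ≤ x → x < y → y < s + n → F x ≢ F y) → Unique (segment F s n)
segment-unique F s zero    F-inj = []
segment-unique F s (suc n) F-inj =
  segment-All F (suc s) n (λ y s<y y<s+n → F-inj ≤-refl s<y (shift-bound y<s+n))
  ∷ segment-unique F (suc s) n (λ s<x x<y y<s+n → F-inj (<⇒≤ s<x) x<y (shift-bound y<s+n))

valueAt-injective : ∀ {N} {w : Fun N} → Injective _≡_ _≡_ w →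
  ∀ {x y} → x < N → y < N → valueAt w x ≡ valueAt w y → x ≡ y
valueAt-injective {w = w} w-inj {x} {y} x<N y<N wx≡wy = begin
  x                  ≡⟨ toℕ-fromℕ< x<N ⟨
  toℕ (fromℕ< x<N)   ≡⟨ cong toℕ (w-inj (toℕ-injective (suc-injective
                          (trans (sym (valueAt-fromℕ< w x<N)) (trans wx≡wy (valueAt-fromℕ< w y<N)))))) ⟩
  toℕ (fromℕ< y<N)   ≡⟨ toℕ-fromℕ< y<N ⟩
  y                  ∎
  where open ≡-Reasoning

line-cfg : ∀ {N} k (w : Fun N) → k ≤ N → line (cfg k w) ≡ segment (valueAt w) 0 N
line-cfg {N} k w k≤N = trans (sym (segment-++ (valueAt w) 0 k (N ∸ k))) (cong (segment (valueAt w) 0) (m+[n∸m]≡n k≤N))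

one-line-exact : ∀ {N} (u : Permutation′ N) → Exact N (segment (valueAt (u ⟨$⟩ʳ_)) 0 N)
one-line-exact {N} u =
    segment-unique F 0 N (λ _ x<y y<N Fx≡Fy → <⇒≢ x<y (valueAt-injective (permutation-injective u) (<-trans x<y y<N) y<N Fx≡Fy))
  , segment-All F 0 N (λ x _ x<N → subst (InRange N) (sym (valueAt-fromℕ< w x<N)) (s≤s z≤n , toℕ<n _))
  , covered
  where
  w = u ⟨$⟩ʳ_
  F = valueAt w
  covered : ∀ z → InRange N z → z ∈ segment F 0 N
  covered (suc z) (_ , z<N) = subst (_∈ segment F 0 N) F-at-preimage (segment-∋ F 0 N z≤n (toℕ<n m))
    where
    m = u ⟨$⟩ˡ fromℕ< z<N
    F-at-preimage : F (toℕ m) ≡ suc z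
    F-at-preimage = trans (valueAt-toℕ w m) (cong suc (trans (cong toℕ (Perm.inverseʳ u)) (toℕ-fromℕ< z<N)))

cfg-exact : ∀ {N} k (u : Permutation′ N) → k ≤ N → Exact N (line (cfg k (u ⟨$⟩ʳ_)))
cfg-exact k u k≤N = subst (Exact _) (sym (line-cfg k (u ⟨$⟩ʳ_) k≤N)) (one-line-exact u)

exact-↭ : ∀ {N l l′} → l ↭ l′ → Exact N l → Exact N l′
exact-↭ l↭l′ (unique , in-range , covers) =
  Unique-resp-↭ (↭⇒↭ₛ l↭l′) unique , All-resp-↭ l↭l′ in-range , (λ z z∈[1,N] → ∈-resp-↭ l↭l′ (covers z z∈[1,N]))

exact-without-max : ∀ {N} A B → Exact (suc N) (A ++ suc N ∷ B) → Exact N (A ++ B)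
exact-without-max {N} A B ex with exact-↭ (shift (suc N) A B) ex
... | (N+1∉ ∷ unique) , (_ ∷ in-range) , covers =
  unique , All.zipWith (λ ((1≤z , z≤N+1) , N+1≢z) → 1≤z , s≤s⁻¹ (≤∧≢⇒< z≤N+1 (N+1≢z ∘ sym))) (in-range , N+1∉) , covers′
  where
  covers′ : ∀ z → InRange N z → z ∈ A ++ B
  covers′ z (1≤z , z≤N) with covers z (1≤z , m≤n⇒m≤1+n z≤N)
  ... | here z≡N+1 = ⊥-elim (<-irrefl z≡N+1 (s≤s z≤N))
  ... | there z∈   = z∈

exact-length : ∀ N {l} → Exact N l → length l ≡ N
exact-length zero    {[]}    _                          = refl
exact-length zero    {z ∷ l} (_ , (1≤z , z≤0) ∷ _ , _)  = ⊥-elim (<-irrefl refl (≤-trans 1≤z z≤0))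
exact-length (suc N) {l}     ex with ∈-∃++ (proj₂ (proj₂ ex) (suc N) (s≤s z≤n , ≤-refl))
... | A , B , refl = begin
  length (A ++ suc N ∷ B)   ≡⟨ length-++ A ⟩
  length A + suc (length B) ≡⟨ +-suc (length A) (length B) ⟩
  suc (length A + length B) ≡⟨ cong suc (trans (sym (length-++ A)) (exact-length N (exact-without-max A B ex))) ⟩
  suc N                     ∎
  where open ≡-Reasoning

-- From configurations to positions

nth : List ℕ → ℕ → ℕ
nth []       _       = 0
nth (x ∷ xs) zero    = x
nth (x ∷ xs) (suc n) = nth xs n

nth-∈ : ∀ xs {n} → n < length xs → nth xs n ∈ xs
nth-∈ (x ∷ xs) {zero}  _         = here refl
nth-∈ (x ∷ xs) {suc n} (s≤s n<l) = there (nth-∈ xs n<l)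

∈⇒nth : ∀ {xs z} → z ∈ xs → Σ ℕ λ n → n < length xs × nth xs n ≡ z
∈⇒nth (here refl) = zero , s≤s z≤n , refl
∈⇒nth (there z∈)  with ∈⇒nth z∈
... | n , n<l , nth≡z = suc n , s≤s n<l , nth≡z

nth-injective : ∀ {xs} → Unique xs → ∀ {m n} → m < length xs → n < length xs → nth xs m ≡ nth xs n → m ≡ n
nth-injective {x ∷ xs} (x∉ ∷ unique) {zero}  {zero}  _          _          _ = refl
nth-injective {x ∷ xs} (x∉ ∷ unique) {zero}  {suc n} _          (s≤s n<l)  e = ⊥-elim (All.lookup x∉ (nth-∈ xs n<l) e)
nth-injective {x ∷ xs} (x∉ ∷ unique) {suc m} {zero}  (s≤s m<l)  _          e = ⊥-elim (All.lookup x∉ (nth-∈ xs m<l) (sym e))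
nth-injective {x ∷ xs} (x∉ ∷ unique) {suc m} {suc n} (s≤s m<l) (s≤s n<l) e = cong suc (nth-injective unique m<l n<l e)

nth-prefix : ∀ X {Y x} → x < length X → nth (X ++ Y) x ∈ X
nth-prefix (_ ∷ X) {x = zero}  _         = here refl
nth-prefix (_ ∷ X) {x = suc x} (s≤s x<l) = there (nth-prefix X x<l)

nth-mid : ∀ A {c} Y → nth (A ++ c ∷ Y) (length A) ≡ c
nth-mid []      Y = refl
nth-mid (_ ∷ A) Y = nth-mid A Y

nth-mid-other : ∀ A {c d} Y {x} → x ≢ length A → nth (A ++ c ∷ Y) x ≡ nth (A ++ d ∷ Y) x
nth-mid-other []      Y {zero}  x≢0   = ⊥-elim (x≢0 refl)
nth-mid-other []      Y {suc x} _     = refl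
nth-mid-other (_ ∷ A) Y {zero}  _     = refl
nth-mid-other (_ ∷ A) Y {suc x} x≢|A| = nth-mid-other A Y (x≢|A| ∘ cong suc)

nth-right : ∀ A {c} X {d} C → nth (A ++ c ∷ X ++ d ∷ C) (length A + suc (length X)) ≡ d
nth-right []      X C = nth-mid X C
nth-right (_ ∷ A) X C = nth-right A X C

module _ (A : List ℕ) (c : ℕ) (X : List ℕ) (d : ℕ) (C : List ℕ) where

  private
    l l′ : List ℕ
    l  = A ++ c ∷ X ++ d ∷ C
    l′ = A ++ d ∷ X ++ c ∷ C

  nth-other : ∀ {x} → x ≢ length A → x ≢ length A + suc (length X) → nth l x ≡ nth l′ x
  nth-other = go A
    where
    go : ∀ A {x} → x ≢ length A → x ≢ length A + suc (length X) → nth (A ++ c ∷ X ++ d ∷ C) x ≡ nth (A ++ d ∷ X ++ c ∷ C) x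
    go []      {zero}  x≢0 _    = ⊥-elim (x≢0 refl)
    go []      {suc x} _   x≢j  = nth-mid-other X C (x≢j ∘ cong suc)
    go (_ ∷ A) {zero}  _   _    = refl
    go (_ ∷ A) {suc x} x≢i x≢j  = go A (x≢i ∘ cong suc) (x≢j ∘ cong suc)

  nth-between : ∀ {x} → length A < x → x < length A + suc (length X) → nth l x ∈ X
  nth-between = go A
    where
    go : ∀ A {x} → length A < x → x < length A + suc (length X) → nth (A ++ c ∷ X ++ d ∷ C) x ∈ X
    go []      {suc x} _         (s≤s x<|X|) = nth-prefix X x<|X|
    go (_ ∷ A) {suc x} (s≤s i<x) (s≤s x<j)   = go A i<x x<j

  nth-swapped : ∀ {M} {i j : Fin M} → toℕ i ≡ length A → toℕ j ≡ length A + suc (length X) →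
    ∀ x → nth l′ (toℕ x) ≡ nth l (toℕ (swapF i j x))
  nth-swapped {i = i} {j} ti tj x with locate i j x
  ... | at-left refl  = begin
    nth l′ (toℕ i)              ≡⟨ trans (cong (nth l′) ti) (nth-mid A (X ++ c ∷ C)) ⟩
    d                           ≡⟨ trans (cong (nth l) tj) (nth-right A X C) ⟨
    nth l (toℕ j)               ≡⟨ cong (nth l ∘ toℕ) (swapF-left i j) ⟨
    nth l (toℕ (swapF i j i))   ∎
    where open ≡-Reasoning
  ... | at-right refl = begin
    nth l′ (toℕ j)              ≡⟨ trans (cong (nth l′) tj) (nth-right A X C) ⟩
    c                           ≡⟨ trans (cong (nth l) ti) (nth-mid A (X ++ d ∷ C)) ⟨
    nth l (toℕ i)               ≡⟨ cong (nth l ∘ toℕ) (swapF-right i j) ⟨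
    nth l (toℕ (swapF i j j))   ∎
    where open ≡-Reasoning
  ... | off x≢i x≢j   = begin
    nth l′ (toℕ x)              ≡⟨ nth-other (λ x≡i → x≢i (toℕ-injective (trans x≡i (sym ti))))
                                             (λ x≡j → x≢j (toℕ-injective (trans x≡j (sym tj)))) ⟨
    nth l (toℕ x)               ≡⟨ cong (nth l ∘ toℕ) (swapF-other x≢i x≢j) ⟨
    nth l (toℕ (swapF i j x))   ∎
    where open ≡-Reasoning

toPosition : ∀ {M z} → InRange M z → Fin M
toPosition {z = suc z} (_ , z<M) = fromℕ< z<M

value-toPosition : ∀ {M z} (r : InRange M z) → suc (toℕ (toPosition r)) ≡ z
value-toPosition {z = suc z} (_ , z<M) = cong suc (toℕ-fromℕ< z<M)

module Line {M : ℕ} {l : List ℕ} (ex : Exact M l) where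

  position< : ∀ (p : Fin M) → toℕ p < length l
  position< p = subst (toℕ p <_) (sym (exact-length M ex)) (toℕ<n p)

  fromLine : Fun M
  fromLine p = toPosition (All.lookup (proj₁ (proj₂ ex)) (nth-∈ l (position< p)))

  value-fromLine : ∀ p → value fromLine p ≡ nth l (toℕ p)
  value-fromLine p = value-toPosition _

  fromLine-injective : Injective _≡_ _≡_ fromLine
  fromLine-injective {p} {q} e = toℕ-injective (nth-injective (proj₁ ex) (position< p) (position< q)
    (trans (sym (value-fromLine p)) (trans (cong (suc ∘ toℕ) e) (value-fromLine q))))

  fromLine-permutation : Permutation′ M
  fromLine-permutation = permutation fromLine position fromLine-position position-fromLine
    where
    index : (v : Fin M) → Σ ℕ λ n → n < length l × nth l n ≡ suc (toℕ v)
    index v = ∈⇒nth (proj₂ (proj₂ ex) (suc (toℕ v)) (s≤s z≤n , toℕ<n v))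
    index<M : ∀ v → proj₁ (index v) < M
    index<M v = subst (proj₁ (index v) <_) (exact-length M ex) (proj₁ (proj₂ (index v)))
    position : Fin M → Fin M
    position v = fromℕ< (index<M v)
    fromLine-position : ∀ v → fromLine (position v) ≡ v
    fromLine-position v = toℕ-injective (suc-injective (begin
      value fromLine (position v)    ≡⟨ value-fromLine (position v) ⟩
      nth l (toℕ (position v))       ≡⟨ cong (nth l) (toℕ-fromℕ< (index<M v)) ⟩
      nth l (proj₁ (index v))        ≡⟨ proj₂ (proj₂ (index v)) ⟩
      suc (toℕ v)                    ∎))
      where open ≡-Reasoning
    position-fromLine : ∀ p → position (fromLine p) ≡ p
    position-fromLine p = toℕ-injective (trans (toℕ-fromℕ< (index<M (fromLine p)))
      (nth-injective (proj₁ ex) (proj₁ (proj₂ (index (fromLine p)))) (position< p)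
        (trans (proj₂ (proj₂ (index (fromLine p)))) (value-fromLine p))))

open Line using (fromLine; value-fromLine; fromLine-injective; fromLine-permutation)

move→exchange : ∀ {M c d κ κ′} (ex : Exact M (line κ)) (ex′ : Exact M (line κ′)) → κ ⟶⟨ c , d ⟩ κ′ →
  Exchange (wall κ) c d (fromLine ex) (fromLine ex′)
move→exchange {M} {c} {d} ex ex′ (exchange A B₁ B₂ C pass) = record
  { i = i ; j = j
  ; i<j = subst₂ _<_ (sym ti) (sym tj) (m<m+n (length A) z<s)
  ; i<k = subst₂ _<_ (sym ti) (sym (length-++ A)) (m<m+n (length A) z<s)
  ; k≤j = subst₂ _≤_ (sym (length-++ A)) (sym tj) (+-monoʳ-≤ (length A) (s≤s (length-++-≤ˡ B₁)))
  ; value-i = trans (value-w i) (trans (cong (nth l) ti) (nth-mid A (X ++ d ∷ C)))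
  ; value-j = trans (value-w j) (trans (cong (nth l) tj) (nth-right A X C))
  ; swapped = λ x → toℕ-injective (suc-injective
      (trans (value-w′ x) (trans (nth-swapped A c X d C ti tj x) (sym (value-w (swapF i j x))))))
  ; passable = λ m (i<m , m<j) → subst (Passable c d) (sym (value-w m))
      (All.lookup pass (nth-between A c X d C (subst (_< toℕ m) ti i<m) (subst (toℕ m <_) tj m<j)))
  }
  where
  X = B₁ ++ B₂
  l l′ : List ℕ
  l  = A ++ c ∷ X ++ d ∷ C
  l′ = A ++ d ∷ X ++ c ∷ C
  reassoc : ∀ x y → (A ++ x ∷ B₁) ++ (B₂ ++ y ∷ C) ≡ A ++ x ∷ X ++ y ∷ C
  reassoc x y = trans (++-assoc A (x ∷ B₁) _) (cong (λ Y → A ++ x ∷ Y) (sym (++-assoc B₁ B₂ (y ∷ C))))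
  w = fromLine ex
  w′ = fromLine ex′
  value-w : ∀ p → value w p ≡ nth l (toℕ p)
  value-w p = trans (value-fromLine ex p) (cong (λ l → nth l (toℕ p)) (reassoc c d))
  value-w′ : ∀ p → value w′ p ≡ nth l′ (toℕ p)
  value-w′ p = trans (value-fromLine ex′ p) (cong (λ l → nth l (toℕ p)) (reassoc d c))
  j<M : length A + suc (length X) < M
  j<M = subst (length A + suc (length X) <_) (trans (cong length (sym (reassoc c d))) (exact-length M ex)) (right<length A)
    where
    right<length : ∀ A → length A + suc (length X) < length (A ++ c ∷ X ++ d ∷ C)
    right<length []      = s<s (subst (length X <_) (sym (length-++ X)) (m<m+n (length X) z<s))
    right<length (_ ∷ A) = s<s (right<length A)
  i j : Fin M
  i = fromℕ< (<-trans (m<m+n (length A) z<s) j<M)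
  j = fromℕ< j<M
  ti : toℕ i ≡ length A
  ti = toℕ-fromℕ< _
  tj : toℕ j ≡ length A + suc (length X)
  tj = toℕ-fromℕ< j<M

move-wall : ∀ {κ κ′ p} → κ ⟶⟨ p ⟩ κ′ → wall κ′ ≡ wall κ
move-wall (exchange A B₁ B₂ C _) = trans (length-++ A) (sym (length-++ A))

move-↭ : ∀ {κ κ′ p} → κ ⟶⟨ p ⟩ κ′ → line κ ↭ line κ′
move-↭ {p = c , d} (exchange A B₁ B₂ C _) = begin
  (A ++ c ∷ B₁) ++ B₂ ++ d ∷ C    ≡⟨ ++-assoc A (c ∷ B₁) _ ⟩
  A ++ (c ∷ B₁ ++ B₂ ++ d ∷ C)    ↭⟨ ++⁺ˡ A (prep c (++⁺ˡ B₁ (shift d B₂ C))) ⟩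
  A ++ (c ∷ B₁ ++ d ∷ B₂ ++ C)    ↭⟨ ++⁺ˡ A (prep c (shift d B₁ (B₂ ++ C))) ⟩
  A ++ (c ∷ d ∷ B₁ ++ B₂ ++ C)    ↭⟨ ++⁺ˡ A (swap c d ↭-refl) ⟩
  A ++ (d ∷ c ∷ B₁ ++ B₂ ++ C)    ↭⟨ ++⁺ˡ A (prep d (↭-sym (shift c B₁ (B₂ ++ C)))) ⟩
  A ++ (d ∷ B₁ ++ c ∷ B₂ ++ C)    ↭⟨ ++⁺ˡ A (prep d (++⁺ˡ B₁ (↭-sym (shift c B₂ C)))) ⟩
  A ++ (d ∷ B₁ ++ B₂ ++ c ∷ C)    ≡⟨ ++-assoc A (d ∷ B₁) _ ⟨
  (A ++ d ∷ B₁) ++ B₂ ++ c ∷ C    ∎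
  where open PermutationReasoning

moves→Run : ∀ {M v κ₀ κ} (ex₀ : Exact M (line κ₀)) → κ₀ ⟶⋆⟨ v ⟩ κ →
  Σ (Exact M (line κ)) λ ex → wall κ ≡ wall κ₀ × Σ (Exps M) λ γ → Run (wall κ₀) v (λ _ → 0) (fromLine ex₀) γ (fromLine ex)
moves→Run ex₀ [] = ex₀ , refl , (λ _ → 0) , (λ _ → refl) , (λ _ → refl)
moves→Run {κ = κ} ex₀ (_◅_ {p = c , d} step run) with moves→Run ex₀ run
... | ex₁ , wall₁≡ , γ₁ , run₁ = ex , trans (move-wall step) wall₁≡ , (λ m → γ₁ m + proj₁ last m) ,
                                  γ₁ , fromLine ex₁ , run₁ , proj₁ last , proj₂ last , (λ _ → refl)
  where
  ex : Exact _ (line κ)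
  ex = exact-↭ (move-↭ step) ex₁
  last = exchange→step (fromLine-injective ex₁)
    (subst (λ k → Exchange k c d (fromLine ex₁) (fromLine ex)) wall₁≡ (move→exchange ex₁ ex step))

moves⇒nonzero : ∀ {M v κ₀ κ} → Exact M (line κ₀) → All (InRange M) (support v) → 1 ≤ wall κ₀ → wall κ₀ ≤ M ∸ 1 →
  κ₀ ⟶⋆⟨ v ⟩ κ → ¬ IsZero v
moves⇒nonzero {M} ex₀ in-range 1≤k k≤M-1 run zero-v with moves→Run ex₀ run
... | ex , _ , γ , defs-run = zero-v M in-range (λ _ → 0) (fromLine-permutation ex₀) _ 1≤k k≤M-1 (γ , fromLine ex , defs-run)

Run→moves : ∀ {N v α γ k} (u : Permutation′ N) {y : Fun N} → k ≤ N → Run k v α (u ⟨$⟩ʳ_) γ y →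
  Σ Cfg λ κ₀ → Σ Cfg λ κ → Exact N (line κ₀) × wall κ₀ ≡ k × κ₀ ⟶⋆⟨ v ⟩ κ
Run→moves {k = k} u {y} k≤N run =
  cfg k (u ⟨$⟩ʳ_) , cfg k y , cfg-exact k u k≤N , length-segment _ 0 k ,
  exchanges→moves (run→exchanges (permutation-injective u) run)

-- Making room for new values

Fresh? : ∀ a b → Decidable (Fresh a b)
Fresh? a b z = ¬? (z ≟ℕ a) ×-dec ¬? (z ≟ℕ b)

module Insertion (N a b : ℕ) where

  M : ℕ
  M = N ⊔ a ⊔ b

  N≤M : N ≤ M
  N≤M = ≤-trans (m≤m⊔n N a) (m≤m⊔n (N ⊔ a) b)

  a≤M : a ≤ M
  a≤M = ≤-trans (m≤n⊔m N a) (m≤m⊔n (N ⊔ a) b)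

  b≤M : b ≤ M
  b≤M = m≤n⊔m (N ⊔ a) b

  fillers : List ℕ
  fillers = filter (λ z → (N <? z) ×-dec Fresh? a b z) (segment id 1 M)

  private
    filler⁻ : ∀ {z} → z ∈ fillers → InRange M z × N < z × Fresh a b z
    filler⁻ z∈ with ∈-filter⁻ (λ z → (N <? z) ×-dec Fresh? a b z) {xs = segment id 1 M} z∈
    ... | z∈[1,M] , filler with segment-∈ id 1 M z∈[1,M]
    ...   | _ , 1≤z , z<1+M , refl = (1≤z , s≤s⁻¹ z<1+M) , filler

  exact-insert : ∀ {l} → 1 ≤ a → 1 ≤ b → a ≢ b → Exact N l → Exact M (a ∷ b ∷ fillers ++ filter (Fresh? a b) l)
  exact-insert {l} 1≤a 1≤b a≢b (unique , in-range , covers) =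
    ( (a≢b ∷ All.tabulate (λ z∈ → proj₁ (fresh z∈) ∘ sym))
      ∷ All.tabulate (λ z∈ → proj₂ (fresh z∈) ∘ sym)
      ∷ Unique.++⁺ (Unique.filter⁺ _ (segment-unique id 1 M (λ _ x<y _ → <⇒≢ x<y)))
                   (Unique.filter⁺ (Fresh? a b) unique)
                   (λ (z∈F , z∈G) → <⇒≱ (proj₁ (proj₂ (filler⁻ z∈F))) (proj₂ (All.lookup in-range (kept z∈G))))
    , (1≤a , a≤M) ∷ (1≤b , b≤M) ∷ All.tabulate in-range′
    , covers′ )
    where
    kept : ∀ {z} → z ∈ filter (Fresh? a b) l → z ∈ l
    kept z∈ = proj₁ (∈-filter⁻ (Fresh? a b) {xs = l} z∈)
    fresh : ∀ {z} → z ∈ fillers ++ filter (Fresh? a b) l → Fresh a b z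
    fresh z∈ with ∈-++⁻ fillers z∈
    ... | inj₁ z∈F = proj₂ (proj₂ (filler⁻ z∈F))
    ... | inj₂ z∈G = proj₂ (∈-filter⁻ (Fresh? a b) {xs = l} z∈G)
    in-range′ : ∀ {z} → z ∈ fillers ++ filter (Fresh? a b) l → InRange M z
    in-range′ z∈ with ∈-++⁻ fillers z∈
    ... | inj₁ z∈F = proj₁ (filler⁻ z∈F)
    ... | inj₂ z∈G = let 1≤z , z≤N = All.lookup in-range (kept z∈G) in 1≤z , ≤-trans z≤N N≤M
    covers′ : ∀ z → InRange M z → z ∈ a ∷ b ∷ fillers ++ filter (Fresh? a b) l
    covers′ z (1≤z , z≤M) with z ≟ℕ a | z ≟ℕ b
    ... | yes z≡a | _       = here z≡a
    ... | no _    | yes z≡b = there (here z≡b)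
    ... | no z≢a  | no z≢b with z ≤? N
    ...   | yes z≤N = there (there (∈-++⁺ʳ fillers (∈-filter⁺ (Fresh? a b) (covers z (1≤z , z≤N)) (z≢a , z≢b))))
    ...   | no z≰N  = there (there (∈-++⁺ˡ (∈-filter⁺ (λ z → (N <? z) ×-dec Fresh? a b z)
                          (segment-∋ id 1 M 1≤z (s≤s z≤M)) (≰⇒> z≰N , z≢a , z≢b))))

filter-split-↭ : ∀ {P : ℕ → Set} (P? : Decidable P) xs → filter (∁? P?) xs ++ filter P? xs ↭ xs
filter-split-↭ P? []       = ↭-refl
filter-split-↭ P? (x ∷ xs) with P? x
... | yes _ = ↭-trans (shift x _ _) (prep x (filter-split-↭ P? xs))
... | no _  = prep x (filter-split-↭ P? xs)

lay-↭ : ∀ a b E L R → line (Layout.lay a b E (L , R)) ↭ a ∷ b ∷ E ++ L ++ R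
lay-↭ a b E L R = begin
  (E ++ f¬ L ++ a ∷ fG L) ++ fG R ++ b ∷ f¬ R     ≡⟨ ++-assoc E _ _ ⟩
  E ++ (f¬ L ++ a ∷ fG L) ++ fG R ++ b ∷ f¬ R     ↭⟨ ++⁺ˡ E (++⁺-↭ (shift a (f¬ L) (fG L)) (shift b (fG R) (f¬ R))) ⟩
  E ++ (a ∷ f¬ L ++ fG L) ++ (b ∷ fG R ++ f¬ R)   ↭⟨ ++⁺ˡ E (prep a (++⁺-↭ (filter-split-↭ G? L)
                                                        (prep b (↭-trans (++-comm (fG R) (f¬ R)) (filter-split-↭ G? R))))) ⟩
  E ++ a ∷ L ++ b ∷ R                             ↭⟨ ++⁺ˡ E (prep a (shift b L R)) ⟩
  E ++ a ∷ b ∷ L ++ R                             ↭⟨ shift a E (b ∷ L ++ R) ⟩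
  a ∷ E ++ b ∷ L ++ R                             ↭⟨ prep a (shift b E (L ++ R)) ⟩
  a ∷ b ∷ E ++ L ++ R                             ∎
  where
  open PermutationReasoning
  G? = Passable? a b
  fG f¬ : List ℕ → List ℕ
  fG = filter G?
  f¬ = filter (∁? G?)

-- Nonvanishing of v_ab v when every letter of v is compatible with v_ab

nonempty : ∀ {x : ℕ} {xs} → x ∈ xs → 1 ≤ length xs
nonempty {xs = _ ∷ _} _ = s≤s z≤n

compatible⇒nonzero : ∀ {N v a b κ₀ κ} → Exact N (line κ₀) → κ₀ ⟶⋆⟨ v ⟩ κ → All (InRange N) (support v) →
  1 ≤ a → 1 ≤ b → a ≢ b → All (Fresh a b) (support v) → All (Compatible a b) v → ¬ IsZero ((a , b) ∷ v)
compatible⇒nonzero {N} {v} {a} {b} {L₀ , R₀} {κ} ex₀ run in-range 1≤a 1≤b a≢b fresh compatible =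
  moves⇒nonzero exact in-range′ (nonempty (∈-++⁺ʳ fillers (∈-++⁺ʳ (filter ¬G? L′) (here refl)))) wall≤M∸1
    (proj₂ (lay-final (filter-cfg (Fresh? a b) κ)) ◅ lay-moves compatible fresh (filter-moves (Fresh? a b) fresh run))
  where
  open Insertion N a b
  open Layout a b fillers
  ¬G? = ∁? (Passable? a b)
  L′ = filter (Fresh? a b) L₀
  R′ = filter (Fresh? a b) R₀
  exact : Exact M (line (lay (L′ , R′)))
  exact = exact-↭ (↭-sym (lay-↭ a b fillers L′ R′))
    (subst (λ l → Exact M (a ∷ b ∷ fillers ++ l)) (filter-++ (Fresh? a b) L₀ R₀) (exact-insert 1≤a 1≤b a≢b ex₀))
  in-range′ : All (InRange M) (support ((a , b) ∷ v))
  in-range′ = (1≤a , a≤M) ∷ (1≤b , b≤M) ∷ All.map (λ (1≤z , z≤N) → 1≤z , ≤-trans z≤N N≤M) in-range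
  wall≤M∸1 : wall (lay (L′ , R′)) ≤ M ∸ 1
  wall≤M∸1 = m+n≤o⇒m≤o∸n _ (subst (wall (lay (L′ , R′)) + 1 ≤_)
    (trans (sym (length-++ (proj₁ (lay (L′ , R′))))) (exact-length M exact))
    (+-monoʳ-≤ (wall (lay (L′ , R′))) (nonempty (∈-++⁺ʳ (filter (Passable? a b) R′) (here refl)))))

exact-[] : Exact 0 []
exact-[] = [] , [] , λ _ (1≤z , z≤0) → ⊥-elim (<-irrefl refl (≤-trans 1≤z z≤0))

compatible-pair⇒nonzero : ∀ {a b c d} → 1 ≤ a → 1 ≤ b → a ≢ b → ValidOp (c , d) → Fresh a b c → Fresh a b d →
  Compatible a b (c , d) → ¬ IsZero ((a , b) ∷ (c , d) ∷ [])
compatible-pair⇒nonzero {a} {b} {c} {d} 1≤a 1≤b a≢b (1≤c , 1≤d , c≢d) fc fd compatible =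
  compatible⇒nonzero exact (exchange [] [] [] fillers [] ◅ [])
    ((1≤c , a≤M) ∷ (1≤d , b≤M) ∷ [])
    1≤a 1≤b a≢b (fc ∷ fd ∷ []) (compatible ∷ [])
  where
  open Insertion 0 c d
  exact : Exact M (c ∷ d ∷ fillers)
  exact = subst (λ l → Exact M (c ∷ d ∷ l)) (++-identityʳ fillers) (exact-insert 1≤c 1≤d c≢d exact-[])

letter-support : ∀ {P : ℕ → Set} {v c d} → All P (support v) → (c , d) ∈ v → P c × P d
letter-support {v = _ ∷ _} (pc ∷ pd ∷ _) (here refl) = pc , pd
letter-support {v = _ ∷ _} (_ ∷ _ ∷ ps) (there p∈v) = letter-support ps p∈v

proposition6p7 : (v : Word) → All ValidOp v → ¬ IsZero v →
    (a b : ℕ) → 1 ≤ a → 1 ≤ b → a ≢ b →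
    ¬ (a ∈ support v) → ¬ (b ∈ support v) →
    (IsZero ((a , b) ∷ v) ⇔ Σ (ℕ × ℕ) λ p → (p ∈ v) × IsZero ((a , b) ∷ p ∷ []))
proposition6p7 v valid nonzero a b 1≤a 1≤b a≢b a∉v b∉v = mk⇔ to from
  where
  fresh : All (Fresh a b) (support v)
  fresh = All.tabulate (λ z∈v → (λ { refl → a∉v z∈v }) , (λ { refl → b∉v z∈v }))

  to : IsZero ((a , b) ∷ v) → Σ (ℕ × ℕ) λ p → (p ∈ v) × IsZero ((a , b) ∷ p ∷ [])
  to vanishes with all? (compatible? a b) v
  ... | yes compatible = ⊥-elim (nonzero λ N in-range _ u k _ k≤N∸1 (_ , _ , run) →
    let _ , _ , exact , _ , run′ = Run→moves u (≤-trans k≤N∸1 (m∸n≤m N 1)) run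
    in compatible⇒nonzero exact run′ in-range 1≤a 1≤b a≢b fresh compatible vanishes)
  ... | no ¬compatible with find (¬All⇒Any¬ (compatible? a b) v ¬compatible)
  ...   | p , p∈v , ¬compatible-p = p , p∈v ,
    incompatible⇒zero (p ∷ []) (let fc , fd = letter-support fresh p∈v in fc ∷ fd ∷ []) (here ¬compatible-p)

  from : (Σ (ℕ × ℕ) λ p → (p ∈ v) × IsZero ((a , b) ∷ p ∷ [])) → IsZero ((a , b) ∷ v)
  from (p , p∈v , vanishes-p) with compatible? a b p
  ... | no ¬compatible = incompatible⇒zero v fresh (lose p∈v ¬compatible)
  ... | yes compatible = let fc , fd = letter-support fresh p∈v in
    ⊥-elim (compatible-pair⇒nonzero 1≤a 1≤b a≢b (All.lookup valid p∈v) fc fd compatible vanishes-p)
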